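{- In the folding setting described in the context, let $K\in Z^+(\mathfrak{g}(A))$. Then $f$ is an isomorphism of graded graphs from $\Gamma_w^A(K)$ onto the folded weak graph $\Gamma_w^B(\varphi(K))^\pi$.
   Context: Let $B=(b_{jk})_{j,k\in J}$ be a generalized Cartan matrix (GCM), $\pi$ an admissible automorphism of $B$ (permutation of $J$ with $b_{\pi(j)\pi(k)}=b_{jk}$ and $b_{jk}=0$ for $j,k$ in the same orbit), $I$ indexing the $\pi$-orbits $O_i$, $o_i=|O_i|$, $A$ the GCM $a_{i'i}=\frac{o_{i'}}{o_i}\sum_{j\in O_i}b_{j'j}$ ($j'\in O_{i'}$). $\alpha_i^\vee,\beta_j^\vee$ simple coroots of $\mathfrak{g}(A),\mathfrak{g}(B)$; $W_A,W_B$ Weyl groups; $f:W_A\to W_B$ the injective homomorphism $f(s_i^A)=\prod_{j\in O_i}s_j^B$ with image $W_B^\pi$ (elements fixed by $s_j\mapsto s_{\pi(j)}$). $\varphi(\alpha_i^\vee)=\sum_{j\in O_i}\beta_j^\vee$ extended linearly. $Z^+(\mathfrak{g})=Z(\mathfrak{g})\cap\bigoplus\mathbb{Z}_{\ge0}(\text{simple coroots})$. For $K=\sum k_k\alpha_k^\vee\in Z^+$, $\Gamma_w(K)$ is the graph on the Weyl group graded by length with an edge $x\to s_kx$ of multiplicity $k_k$ for each left weak cover $x\prec s_kx$. The folded weak graph $\Gamma_w^B(\varphi(K))^\pi$ has vertex set $W_B^\pi$, grading $f(w)\mapsto\ell(w)$, and for each $v\in W_A$ and $i\in I$ with $v\prec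 s_iv$ an edge $f(v)\to f(s_iv)$ whose multiplicity is the multiplicity of the edge $f(v)\to s_jf(v)$ in $\Gamma_w^B(\varphi(K))$ for some (any) $j\in O_i$, namely the coefficient of $\beta_j^\vee$ in $\varphi(K)$. -}

module Defs where

open import Data.Nat as ℕ using (ℕ; zero; suc; _≤_)
open import Data.Integer as ℤ using (ℤ; +_; _+_; _-_; _*_)
open import Data.Fin using (Fin; zero; suc; _≟_)
open import Data.Fin.Permutation using (Permutation′; _⟨$⟩ʳ_)
open import Data.List using (List; []; _∷_; length; filter; concatMap; map; allFin)
open import Data.Bool using (if_then_else_)
open import Data.Product using (Σ; ∃; _×_; _,_)
open import Data.Sum using (_⊎_)
open import Relation.Nullary using (¬_; does)
open import Relation.Binary.PropositionalEquality using (_≡_; _≢_)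
open import Function.Bundles using (_⇔_)

sumF : ∀ {N} → (Fin N → ℤ) → ℤ
sumF {zero}  f = + 0
sumF {suc N} f = f zero + sumF (λ j → f (suc j))

Matrix : ℕ → Set
Matrix n = Fin n → Fin n → ℤ

record IsGCM {n : ℕ} (A : Matrix n) : Set where
  field
    diag    : ∀ i → A i i ≡ + 2
    offdiag : ∀ i j → i ≢ j → A i j ℤ.≤ + 0
    zeroSym : ∀ i j → A i j ≡ + 0 → A j i ≡ + 0

-- Weyl group W(A), realised as words in the simple reflections modulo
-- equality of their action on the root lattice Q = ⊕ ℤ α_j (faithful).
-- Convention (Kac): a_ij = ⟨α_i^∨, α_j⟩, so s_i(α_j) = α_j - a_ij α_i.
-- A vector c : Fin n → ℤ is the element Σ_j c_j α_j.

sref : ∀ {n} → Matrix n → Fin n → (Fin n → ℤ) → (Fin n → ℤ)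
sref A i c k = if does (k ≟ i) then c k - sumF (λ j → A i j * c j) else c k

-- the word i₁ ∷ i₂ ∷ … ∷ iₘ ∷ [] denotes s_{i₁} s_{i₂} ⋯ s_{iₘ}
Word : ℕ → Set
Word n = List (Fin n)

act : ∀ {n} → Matrix n → Word n → (Fin n → ℤ) → (Fin n → ℤ)
act A []      c = c
act A (i ∷ w) c = sref A i (act A w c)

_≈[_]_ : ∀ {n} → Word n → Matrix n → Word n → Set
u ≈[ A ] v = ∀ c k → act A u c k ≡ act A v c k

IsLength : ∀ {n} → Matrix n → Word n → ℕ → Set
IsLength A w m =
  (Σ (Word _) λ u → length u ≡ m × u ≈[ A ] w) ×
  (∀ u → u ≈[ A ] w → m ≤ length u)

Cover : ∀ {n} → Matrix n → Word n → Fin n → Set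
Cover A x k = Σ ℕ λ m → IsLength A x m × IsLength A (k ∷ x) (suc m)

-- Z⁺(g(A)): K = Σ k_i α_i^∨ with k_i ∈ ℤ≥0 and α_j(K) = Σ_i k_i a_ij = 0

InZPlus : ∀ {n} → Matrix n → (Fin n → ℕ) → Set
InZPlus A K = ∀ j → sumF (λ i → + K i * A i j) ≡ + 0

EdgeMult : ∀ {n} → Matrix n → (Fin n → ℕ) → Word n → Word n → ℕ → Set
EdgeMult A K x y m =
  (Σ (Fin _) λ k → y ≈[ A ] (k ∷ x) × Cover A x k × m ≡ K k) ⊎
  ((∀ k → y ≈[ A ] (k ∷ x) → ¬ Cover A x k) × m ≡ 0)

iter : ∀ {N} → Permutation′ N → ℕ → Fin N → Fin N
iter π zero    j = j
iter π (suc m) j = π ⟨$⟩ʳ (iter π m j)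

orbit : ∀ {n N} → (Fin N → Fin n) → Fin n → List (Fin N)
orbit {N = N} orb i = filter (λ j → orb j ≟ i) (allFin N)

card : ∀ {n N} → (Fin N → Fin n) → Fin n → ℕ
card orb i = length (orbit orb i)

record FoldingSetting (n N : ℕ) : Set where
  field
    B      : Matrix N
    B-gcm  : IsGCM B
    π      : Permutation′ N
    π-inv  : ∀ j k → B (π ⟨$⟩ʳ j) (π ⟨$⟩ʳ k) ≡ B j k
    π-adm  : ∀ j k → j ≢ k → (Σ ℕ λ m → iter π m j ≡ k) → B j k ≡ + 0
    -- orb : J → I sends j to the index of its π-orbit; I indexes the orbits
    orb      : Fin N → Fin n
    orb-surj : ∀ i → Σ (Fin N) λ j → orb j ≡ i
    orb-spec : ∀ j k → (orb j ≡ orb k) ⇔ (Σ ℕ λ m → iter π m j ≡ k)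
    -- the folded matrix  a_{i'i} = (o_{i'}/o_i) Σ_{j∈O_i} b_{j'j}  (j' ∈ O_{i'}),
    -- denominators cleared
    A      : Matrix n
    A-def  : ∀ i' i j' → orb j' ≡ i' →
             + card orb i * A i' i ≡
             + card orb i' * sumF (λ j → if does (orb j ≟ i) then B j' j else + 0)

module Folding {n N : ℕ} (S : FoldingSetting n N) where
  open FoldingSetting S

  f : Word n → Word N
  f = concatMap (orbit orb)

  σ : Word N → Word N
  σ = map (π ⟨$⟩ʳ_)

  Fixed : Word N → Set
  Fixed u = σ u ≈[ B ] u

  -- φ(K) = Σ_i k_i Σ_{j∈O_i} β_j^∨
  φ : (Fin n → ℕ) → (Fin N → ℕ)
  φ K j = K (orb j)

  -- grading of the folded graph: f(w) ↦ ℓ(w)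
  FoldGrade : Word N → ℕ → Set
  FoldGrade u m = Σ (Word n) λ w → f w ≈[ B ] u × IsLength A w m

  FoldMult : (Fin n → ℕ) → Word N → Word N → ℕ → Set
  FoldMult K u u' m =
    (Σ (Word n) λ v → Σ (Fin n) λ i →
       f v ≈[ B ] u × f (i ∷ v) ≈[ B ] u' × Cover A v i ×
       (∀ j → orb j ≡ i → EdgeMult B (φ K) (f v) (j ∷ f v) m)) ⊎
    ((∀ v i → f v ≈[ B ] u → f (i ∷ v) ≈[ B ] u' → ¬ Cover A v i) × m ≡ 0)

  -- f is an isomorphism of graded graphs Γ_w^A(K) ≅ Γ_w^B(φ(K))^π
  -- (including that φ(K) ∈ Z⁺(g(B)), so the target graph is defined)
  record IsGradedIso (K : Fin n → ℕ) : Set where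
    field
      φK-central  : InZPlus B (φ K)
      f-resp      : ∀ u v → u ≈[ A ] v → f u ≈[ B ] f v
      f-fixed     : ∀ w → Fixed (f w)
      f-injective : ∀ u v → f u ≈[ B ] f v → u ≈[ A ] v
      f-onto      : ∀ u → Fixed u → Σ (Word n) λ w → f w ≈[ B ] u
      f-grade     : ∀ w m → IsLength A w m ⇔ FoldGrade (f w) m
      f-edges     : ∀ x y m → EdgeMult A K x y m ⇔ FoldMult K (f x) (f y) m

-- The key fact is Tits' positivity theorem: ℓ(s w) > ℓ(w) exactly when w⁻¹ α_s is a nonnegative
-- combination of simple roots. It is proved by induction on ℓ(w): write w = s' ⋯ with s' ≠ s, split
-- off the longest alternating word in s' and s, and use that in rank two the relevant roots stay in
-- the cone spanned by α_s and α_s' (by evaluation for the four finite dihedral types, by a growth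
-- estimate when a_{ss'} a_{s's} ≥ 4).
--
-- For the folding let χ : Q_B → Q_A send β_j to α_(orb j). The reflections of one π-orbit are
-- pairwise orthogonal, so their product acts through χ as s_i, i.e. χ ∘ f(w) = w ∘ χ. Hence f is
-- well defined and injective. As χ preserves the sign of roots, an ascent i of v gives an ascent j
-- of f(v) for every j ∈ O_i, which matches the covers and the edge multiplicities. Finally the
-- descents of a π-fixed element form a union of orbits, so peeling off f(s_i) shows by induction on
-- the length that every π-fixed element lies in the image of f.

module Submission where

open import Defs
open import Data.Bool using (true; false; if_then_else_)
open import Data.Empty using (⊥; ⊥-elim)
open import Data.Fin using (Fin; zero; suc; _≟_)
import Data.Fin.Properties as Finₚ
open import Data.Fin.Permutation using (_⟨$⟩ʳ_; _⟨$⟩ˡ_; inverseˡ; inverseʳ)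
open import Data.Integer as ℤ using (ℤ; +_; -[1+_]; _+_; _-_; _*_; -_; _⊖_)
import Data.Integer.Properties as ℤₚ
open import Algebra.Properties.Semiring.Sum ℤₚ.+-*-semiring
  using (sum; sum-cong-≗; ∑-distrib-+; *-distribˡ-sum; *-distribʳ-sum; ∑-comm; sum-permute; sum-replicate-zero)
open import Data.Integer.Tactic.RingSolver using (solve-∀)
open import Data.List using ([]; _∷_; _++_; [_]; length; reverse; filter; tabulate; allFin)
import Data.List.Properties as Listₚ
open import Data.List.Membership.Propositional using (_∈_; _∉_)
open import Data.List.Membership.Propositional.Properties using (∈-filter⁺; ∈-filter⁻; ∈-allFin; ∈-map⁺; ∈-map⁻)
import Data.List.Relation.Binary.Permutation.Setoid as Perm
import Data.List.Relation.Binary.Permutation.Setoid.Properties as Permₚ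
import Data.List.Relation.Unary.All as All
open import Data.List.Relation.Unary.AllPairs using (_∷_)
open import Data.List.Relation.Unary.Any using (here; there)
import Data.List.Relation.Unary.Any as Any
import Data.List.Relation.Unary.Any.Properties as Anyₚ
open import Data.List.Relation.Unary.Unique.Propositional using (Unique)
import Data.List.Relation.Unary.Unique.Propositional.Properties as Uniqueₚ
open import Data.Nat as ℕ using (ℕ; zero; suc; _<_; _≤_; _∸_; z≤n; s≤s)
open import Data.Nat.Induction using (<-wellFounded)
import Data.Nat.Properties as ℕₚ
import Data.Nat.Tactic.RingSolver as ℕSolver
open import Data.Product using (Σ; _×_; _,_; proj₁; proj₂; map₂)
open import Data.Sum using (_⊎_; inj₁; inj₂)
open import Function.Base using (_∘_)
open import Function.Bundles using (Equivalence; mk⇔; _⇔_)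
open import Induction.WellFounded using (Acc; acc)
open import Relation.Binary.Bundles using (Setoid)
open import Relation.Binary.PropositionalEquality
  using (_≡_; _≢_; refl; sym; trans; cong; cong₂; cong-app; subst; subst₂; _≗_; setoid; module ≡-Reasoning)
import Relation.Binary.Reasoning.Setoid as SetoidReasoning
open import Relation.Nullary using (¬_; Dec; yes; no; does; map′; contradiction)
open import Relation.Nullary.Decidable using (True; toWitness; _×-dec_)
open import Relation.Unary using (Decidable)

sumF≡sum : ∀ {N} (f : Fin N → ℤ) → sumF f ≡ sum f
sumF≡sum {zero}  f = refl
sumF≡sum {suc N} f = cong (_+_ (f zero)) (sumF≡sum (f ∘ suc))

δ : ∀ {N} → Fin N → Fin N → ℤ
δ k j = if does (j ≟ k) then + 1 else + 0

δ-diag : ∀ {N} (k : Fin N) → δ k k ≡ + 1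
δ-diag k with k ≟ k
... | yes _ = refl
... | no k≢k = ⊥-elim (k≢k refl)

δ-off : ∀ {N} {k j : Fin N} → j ≢ k → δ k j ≡ + 0
δ-off {k = k} {j} j≢k with j ≟ k
... | yes j≡k = ⊥-elim (j≢k j≡k)
... | no _ = refl

δ-sym : ∀ {N} (j k : Fin N) → δ j k ≡ δ k j
δ-sym j k with k ≟ j | j ≟ k
... | yes _    | yes _    = refl
... | no _     | no _     = refl
... | yes k≡j  | no j≢k   = ⊥-elim (j≢k (sym k≡j))
... | no k≢j   | yes j≡k  = ⊥-elim (k≢j (sym j≡k))

sum-δ : ∀ {N} (f : Fin N → ℤ) (k : Fin N) → sum (λ j → f j * δ k j) ≡ f k
sum-δ {suc N} f zero = begin
  f zero * + 1 + sum (λ j → f (suc j) * + 0) ≡⟨ cong₂ _+_ (ℤₚ.*-identityʳ (f zero))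
                                                   (trans (sum-cong-≗ (ℤₚ.*-zeroʳ ∘ f ∘ suc)) (sum-replicate-zero N)) ⟩
  f zero + + 0                               ≡⟨ ℤₚ.+-identityʳ (f zero) ⟩
  f zero                                     ∎
  where open ≡-Reasoning
sum-δ {suc N} f (suc k) =
  trans (cong₂ _+_ (ℤₚ.*-zeroʳ (f zero)) (sum-δ (f ∘ suc) k)) (ℤₚ.+-identityˡ _)

δ-* : ∀ {N} (f : Fin N → ℤ) (k j : Fin N) → δ k j * f j ≡ f k * δ k j
δ-* f k j with j ≟ k
... | yes refl = ℤₚ.*-comm (+ 1) (f j)
... | no _     = trans (ℤₚ.*-zeroˡ (f j)) (sym (ℤₚ.*-zeroʳ (f k)))

sum-nonpos : ∀ {N} (f : Fin N → ℤ) → (∀ j → f j ℤ.≤ + 0) → sum f ℤ.≤ + 0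
sum-nonpos {zero}  f f≤0 = ℤ.+≤+ ℕ.z≤n
sum-nonpos {suc N} f f≤0 = ℤₚ.+-mono-≤ (f≤0 zero) (sum-nonpos (f ∘ suc) (f≤0 ∘ suc))

nonpos-+-≡0 : ∀ {a b} → a ℤ.≤ + 0 → b ℤ.≤ + 0 → a + b ≡ + 0 → a ≡ + 0 × b ≡ + 0
nonpos-+-≡0 {a} {b} a≤0 b≤0 a+b≡0 = a≡0 , trans (sym (ℤₚ.+-identityˡ b)) (trans (cong (_+ b) (sym a≡0)) a+b≡0)
  where
  0≤a : + 0 ℤ.≤ a
  0≤a = subst₂ ℤ._≤_ a+b≡0 (ℤₚ.+-identityʳ a) (ℤₚ.+-monoʳ-≤ a b≤0)
  a≡0 : a ≡ + 0
  a≡0 = ℤₚ.≤-antisym a≤0 0≤a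

sum-nonpos-≡0 : ∀ {N} (f : Fin N → ℤ) → (∀ j → f j ℤ.≤ + 0) → sum f ≡ + 0 → ∀ j → f j ≡ + 0
sum-nonpos-≡0 {suc N} f f≤0 Σf≡0 j
  with nonpos-+-≡0 (f≤0 zero) (sum-nonpos (f ∘ suc) (f≤0 ∘ suc)) Σf≡0
sum-nonpos-≡0 {suc N} f f≤0 Σf≡0 zero    | f0≡0 , _ = f0≡0
sum-nonpos-≡0 {suc N} f f≤0 Σf≡0 (suc j) | _ , Σf'≡0 = sum-nonpos-≡0 (f ∘ suc) (f≤0 ∘ suc) Σf'≡0 j

sum-indicator : ∀ {N A : ℕ} {P : Fin N → Set} (P? : Decidable P) (f : Fin A → Fin N) →
  sum (λ j → if does (P? (f j)) then + 1 else + 0) ≡ + length (filter P? (tabulate f))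
sum-indicator {A = zero}  P? f = refl
sum-indicator {A = suc A} P? f with does (P? (f zero))
... | true  = cong (_+_ (+ 1)) (sum-indicator P? (f ∘ suc))
... | false = trans (ℤₚ.+-identityˡ _) (sum-indicator P? (f ∘ suc))

minimal : ∀ {Q : ℕ → Set} → Decidable Q → ∀ m → Q m → Σ ℕ λ k → Q k × (∀ j → j < k → ¬ Q j)
minimal {Q} Q? m Qm = go m Qm (<-wellFounded m)
  where
  go : ∀ m → Q m → Acc _<_ m → Σ ℕ λ k → Q k × (∀ j → j < k → ¬ Q j)
  go m Qm (acc rs) with ℕₚ.anyUpTo? Q? m
  ... | yes (k , k<m , Qk) = go k Qk (rs k<m)
  ... | no ∄smaller        = m , Qm , λ j j<m Qj → ∄smaller (j , j<m , Qj)

Lattice : ℕ → Set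
Lattice n = Fin n → ℤ

infixl 6 _⊕_
infixl 7 _⊛_

_⊕_ : ∀ {n} → Lattice n → Lattice n → Lattice n
(c ⊕ d) k = c k + d k

_⊛_ : ∀ {n} → ℤ → Lattice n → Lattice n
(z ⊛ c) k = z * c k

𝟎 : ∀ {n} → Lattice n
𝟎 _ = + 0

basis-expansion : ∀ {n} (c : Lattice n) k → c k ≡ sum (λ j → c j * δ j k)
basis-expansion c k = trans (sym (sum-δ c k)) (sum-cong-≗ (λ j → cong (c j *_) (δ-sym k j)))

infix 4 _≥𝟎 _≤𝟎

_≥𝟎 : ∀ {n} → Lattice n → Set
c ≥𝟎 = ∀ k → + 0 ℤ.≤ c k

_≤𝟎 : ∀ {n} → Lattice n → Set
c ≤𝟎 = ∀ k → c k ℤ.≤ + 0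

*-nonneg : ∀ {a b} → + 0 ℤ.≤ a → + 0 ℤ.≤ b → + 0 ℤ.≤ a * b
*-nonneg {+ x} {+ y} _ _ = subst (+ 0 ℤ.≤_) (ℤₚ.pos-* x y) (ℤ.+≤+ z≤n)

≥𝟎-resp : ∀ {n} {c d : Lattice n} → c ≗ d → c ≥𝟎 → d ≥𝟎
≥𝟎-resp c≗d c≥0 k = subst (+ 0 ℤ.≤_) (c≗d k) (c≥0 k)

δ≥𝟎 : ∀ {n} (s : Fin n) → δ s ≥𝟎
δ≥𝟎 s k with k ≟ s
... | yes _ = ℤ.+≤+ z≤n
... | no _  = ℤ.+≤+ z≤n

-1⊛≥𝟎⇒≤𝟎 : ∀ {n} {c : Lattice n} → (- + 1) ⊛ c ≥𝟎 → c ≤𝟎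
-1⊛≥𝟎⇒≤𝟎 {c = c} -c≥0 k =
  subst (ℤ._≤ + 0) (ℤₚ.neg-involutive (c k)) (ℤₚ.neg-mono-≤ (subst (+ 0 ℤ.≤_) (ℤₚ.-1*i≡-i (c k)) (-c≥0 k)))

module Reflections {n : ℕ} (M : Matrix n) (M-diag : ∀ i → M i i ≡ + 2) where

  ⟪_,_⟫ : Fin n → Lattice n → ℤ
  ⟪ i , c ⟫ = sum (λ j → M i j * c j)

  ⟪⟫-cong : ∀ i {c d} → c ≗ d → ⟪ i , c ⟫ ≡ ⟪ i , d ⟫
  ⟪⟫-cong i c≗d = sum-cong-≗ (cong (M i _ *_) ∘ c≗d)

  ⟪⟫-⊕ : ∀ i c d → ⟪ i , c ⊕ d ⟫ ≡ ⟪ i , c ⟫ + ⟪ i , d ⟫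
  ⟪⟫-⊕ i c d = trans (sum-cong-≗ (λ j → ℤₚ.*-distribˡ-+ (M i j) (c j) (d j))) (∑-distrib-+ {n} _ _)

  ⟪⟫-⊛ : ∀ i z c → ⟪ i , z ⊛ c ⟫ ≡ z * ⟪ i , c ⟫
  ⟪⟫-⊛ i z c = trans (sum-cong-≗ (λ j → lemma (M i j) z (c j))) (sym (*-distribˡ-sum {n} z _))
    where
    lemma : ∀ a z x → a * (z * x) ≡ z * (a * x)
    lemma = solve-∀

  ⟪⟫-δ : ∀ i j → ⟪ i , δ j ⟫ ≡ M i j
  ⟪⟫-δ i = sum-δ (M i)

  sref-≡ : ∀ i c k → sref M i c k ≡ c k - ⟪ i , c ⟫ * δ i k
  sref-≡ i c k with k ≟ i
  ... | yes _ = cong (_-_ (c k)) (trans (sumF≡sum {n} _) (sym (ℤₚ.*-identityʳ _)))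
  ... | no _  = sym (trans (cong (_-_ (c k)) (ℤₚ.*-zeroʳ ⟪ i , c ⟫)) (ℤₚ.+-identityʳ (c k)))

  sref-cong : ∀ i {c d} → c ≗ d → sref M i c ≗ sref M i d
  sref-cong i {c} {d} c≗d k = begin
    sref M i c k                ≡⟨ sref-≡ i c k ⟩
    c k - ⟪ i , c ⟫ * δ i k     ≡⟨ cong₂ (λ x y → x - y * δ i k) (c≗d k) (⟪⟫-cong i c≗d) ⟩
    d k - ⟪ i , d ⟫ * δ i k     ≡⟨ sym (sref-≡ i d k) ⟩
    sref M i d k                ∎
    where open ≡-Reasoning

  sref-⊕ : ∀ i c d → sref M i (c ⊕ d) ≗ sref M i c ⊕ sref M i d
  sref-⊕ i c d k = begin
    sref M i (c ⊕ d) k                                   ≡⟨ sref-≡ i (c ⊕ d) k ⟩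
    c k + d k - ⟪ i , c ⊕ d ⟫ * δ i k                    ≡⟨ cong (λ x → c k + d k - x * δ i k) (⟪⟫-⊕ i c d) ⟩
    c k + d k - (⟪ i , c ⟫ + ⟪ i , d ⟫) * δ i k          ≡⟨ lemma (c k) (d k) ⟪ i , c ⟫ ⟪ i , d ⟫ (δ i k) ⟩
    (c k - ⟪ i , c ⟫ * δ i k) + (d k - ⟪ i , d ⟫ * δ i k) ≡⟨ sym (cong₂ _+_ (sref-≡ i c k) (sref-≡ i d k)) ⟩
    sref M i c k + sref M i d k                          ∎
    where
    open ≡-Reasoning
    lemma : ∀ a b x y e → a + b - (x + y) * e ≡ (a - x * e) + (b - y * e)
    lemma = solve-∀

  sref-⊛ : ∀ i z c → sref M i (z ⊛ c) ≗ z ⊛ sref M i c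
  sref-⊛ i z c k = begin
    sref M i (z ⊛ c) k                  ≡⟨ sref-≡ i (z ⊛ c) k ⟩
    z * c k - ⟪ i , z ⊛ c ⟫ * δ i k     ≡⟨ cong (λ x → z * c k - x * δ i k) (⟪⟫-⊛ i z c) ⟩
    z * c k - z * ⟪ i , c ⟫ * δ i k     ≡⟨ lemma z (c k) ⟪ i , c ⟫ (δ i k) ⟩
    z * (c k - ⟪ i , c ⟫ * δ i k)       ≡⟨ cong (z *_) (sym (sref-≡ i c k)) ⟩
    z * sref M i c k                    ∎
    where
    open ≡-Reasoning
    lemma : ∀ z a x e → z * a - z * x * e ≡ z * (a - x * e)
    lemma = solve-∀

  ⟪⟫-sref-self : ∀ i c → ⟪ i , sref M i c ⟫ ≡ - ⟪ i , c ⟫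
  ⟪⟫-sref-self i c = begin
    ⟪ i , sref M i c ⟫                          ≡⟨ ⟪⟫-cong i (λ k → trans (sref-≡ i c k) (lemma₁ (c k) ⟪ i , c ⟫ (δ i k))) ⟩
    ⟪ i , c ⊕ (- ⟪ i , c ⟫) ⊛ δ i ⟫             ≡⟨ ⟪⟫-⊕ i c _ ⟩
    ⟪ i , c ⟫ + ⟪ i , (- ⟪ i , c ⟫) ⊛ δ i ⟫     ≡⟨ cong (_+_ ⟪ i , c ⟫) (⟪⟫-⊛ i (- ⟪ i , c ⟫) (δ i)) ⟩
    ⟪ i , c ⟫ + (- ⟪ i , c ⟫) * ⟪ i , δ i ⟫     ≡⟨ cong (λ x → ⟪ i , c ⟫ + (- ⟪ i , c ⟫) * x) (trans (⟪⟫-δ i i) (M-diag i)) ⟩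
    ⟪ i , c ⟫ + (- ⟪ i , c ⟫) * + 2             ≡⟨ lemma₂ ⟪ i , c ⟫ ⟩
    - ⟪ i , c ⟫                                 ∎
    where
    open ≡-Reasoning
    lemma₁ : ∀ a x e → a - x * e ≡ a + (- x) * e
    lemma₁ = solve-∀
    lemma₂ : ∀ x → x + (- x) * + 2 ≡ - x
    lemma₂ = solve-∀

  sref-involutive : ∀ i c → sref M i (sref M i c) ≗ c
  sref-involutive i c k = begin
    sref M i (sref M i c) k                                   ≡⟨ sref-≡ i (sref M i c) k ⟩
    sref M i c k - ⟪ i , sref M i c ⟫ * δ i k                 ≡⟨ cong₂ (λ x y → x - y * δ i k) (sref-≡ i c k) (⟪⟫-sref-self i c) ⟩
    c k - ⟪ i , c ⟫ * δ i k - (- ⟪ i , c ⟫) * δ i k           ≡⟨ lemma (c k) ⟪ i , c ⟫ (δ i k) ⟩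
    c k                                                       ∎
    where
    open ≡-Reasoning
    lemma : ∀ a x e → a - x * e - (- x) * e ≡ a
    lemma = solve-∀

  sref-δ-self : ∀ i → sref M i (δ i) ≗ (- + 1) ⊛ δ i
  sref-δ-self i k = begin
    sref M i (δ i) k                    ≡⟨ sref-≡ i (δ i) k ⟩
    δ i k - ⟪ i , δ i ⟫ * δ i k         ≡⟨ cong (λ x → δ i k - x * δ i k) (trans (⟪⟫-δ i i) (M-diag i)) ⟩
    δ i k - + 2 * δ i k                 ≡⟨ lemma (δ i k) ⟩
    (- + 1) * δ i k                     ∎
    where
    open ≡-Reasoning
    lemma : ∀ d → d - + 2 * d ≡ (- + 1) * d
    lemma = solve-∀

  act-cong : ∀ w {c d} → c ≗ d → act M w c ≗ act M w d
  act-cong []      c≗d = c≗d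
  act-cong (i ∷ w) c≗d = sref-cong i (act-cong w c≗d)

  act-⊕ : ∀ w c d → act M w (c ⊕ d) ≗ act M w c ⊕ act M w d
  act-⊕ []      c d k = refl
  act-⊕ (i ∷ w) c d k = trans (sref-cong i (act-⊕ w c d) k) (sref-⊕ i (act M w c) (act M w d) k)

  act-⊛ : ∀ w z c → act M w (z ⊛ c) ≗ z ⊛ act M w c
  act-⊛ []      z c k = refl
  act-⊛ (i ∷ w) z c k = trans (sref-cong i (act-⊛ w z c) k) (sref-⊛ i z (act M w c) k)

  act-𝟎 : ∀ w → act M w 𝟎 ≗ 𝟎
  act-𝟎 w k = act-⊛ w (+ 0) 𝟎 k

  act-sum : ∀ {N} w (g : Fin N → Lattice n) k → act M w (λ k → sum (λ j → g j k)) k ≡ sum (λ j → act M w (g j) k)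
  act-sum {zero}  w g k = act-𝟎 w k
  act-sum {suc N} w g k =
    trans (act-⊕ w (g zero) (λ k → sum (λ j → g (suc j) k)) k)
          (cong (_+_ (act M w (g zero) k)) (act-sum w (g ∘ suc) k))

  act-++ : ∀ u v c → act M (u ++ v) c ≡ act M u (act M v c)
  act-++ []      v c = refl
  act-++ (i ∷ u) v c = cong (sref M i) (act-++ u v c)

  -- _≈[ M ]_ unfolds to a Π-type from which Agda cannot recover the two words;
  -- the record wrapper makes them inferable.
  infix 4 _≈_
  record _≈_ (u v : Word n) : Set where
    constructor mk≈
    field act-≈ : u ≈[ M ] v
  open _≈_ public

  ≈-refl : ∀ {u} → u ≈ u
  ≈-refl = mk≈ λ _ _ → refl

  ≈-sym : ∀ {u v} → u ≈ v → v ≈ u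
  ≈-sym (mk≈ u≈v) = mk≈ λ c k → sym (u≈v c k)

  ≈-trans : ∀ {u v w} → u ≈ v → v ≈ w → u ≈ w
  ≈-trans (mk≈ u≈v) (mk≈ v≈w) = mk≈ λ c k → trans (u≈v c k) (v≈w c k)

  ≈-setoid : Setoid _ _
  ≈-setoid = record
    { Carrier       = Word n
    ; _≈_           = _≈_
    ; isEquivalence = record { refl = ≈-refl ; sym = ≈-sym ; trans = ≈-trans }
    }

  module ≈-Reasoning = SetoidReasoning ≈-setoid

  ≡⇒≈ : ∀ {u v} → u ≡ v → u ≈ v
  ≡⇒≈ refl = ≈-refl

  ∷-cong : ∀ i {u v} → u ≈ v → i ∷ u ≈ i ∷ v
  ∷-cong i (mk≈ u≈v) = mk≈ λ c → sref-cong i (u≈v c)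

  ++-cong : ∀ {u u' v v'} → u ≈ u' → v ≈ v' → u ++ v ≈ u' ++ v'
  ++-cong {u} {u'} {v} {v'} (mk≈ u≈u') (mk≈ v≈v') = mk≈ λ c k → begin
    act M (u ++ v) c k         ≡⟨ cong-app (act-++ u v c) k ⟩
    act M u (act M v c) k      ≡⟨ act-cong u (v≈v' c) k ⟩
    act M u (act M v' c) k     ≡⟨ u≈u' (act M v' c) k ⟩
    act M u' (act M v' c) k    ≡⟨ cong-app (act-++ u' v' c) k ⟨
    act M (u' ++ v') c k       ∎
    where open ≡-Reasoning

  s²≈id : ∀ i w → i ∷ i ∷ w ≈ w
  s²≈id i w = mk≈ λ c → sref-involutive i (act M w c)

  act⁻¹ : Word n → Lattice n → Lattice n
  act⁻¹ w = act M (reverse w)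

  act⁻¹-∷ : ∀ i w c → act⁻¹ (i ∷ w) c ≡ act⁻¹ w (sref M i c)
  act⁻¹-∷ i w c = trans (cong (λ u → act M u c) (Listₚ.unfold-reverse i w)) (act-++ (reverse w) [ i ] c)

  act⁻¹-++ : ∀ u v c → act⁻¹ (u ++ v) c ≡ act⁻¹ v (act⁻¹ u c)
  act⁻¹-++ u v c = trans (cong (λ w → act M w c) (Listₚ.reverse-++ u v)) (act-++ (reverse v) (reverse u) c)

  act⁻¹-act : ∀ w c → act⁻¹ w (act M w c) ≗ c
  act⁻¹-act []      c k = refl
  act⁻¹-act (i ∷ w) c k = begin
    act⁻¹ (i ∷ w) (sref M i (act M w c)) k      ≡⟨ cong-app (act⁻¹-∷ i w _) k ⟩
    act⁻¹ w (sref M i (sref M i (act M w c))) k ≡⟨ act-cong (reverse w) (sref-involutive i (act M w c)) k ⟩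
    act⁻¹ w (act M w c) k                       ≡⟨ act⁻¹-act w c k ⟩
    c k                                         ∎
    where open ≡-Reasoning

  act-act⁻¹ : ∀ w c → act M w (act⁻¹ w c) ≗ c
  act-act⁻¹ []      c k = refl
  act-act⁻¹ (i ∷ w) c k = begin
    sref M i (act M w (act⁻¹ (i ∷ w) c)) k       ≡⟨ cong (λ d → sref M i (act M w d) k) (act⁻¹-∷ i w c) ⟩
    sref M i (act M w (act⁻¹ w (sref M i c))) k  ≡⟨ sref-cong i (act-act⁻¹ w (sref M i c)) k ⟩
    sref M i (sref M i c) k                      ≡⟨ sref-involutive i c k ⟩
    c k                                          ∎
    where open ≡-Reasoning

  act⁻¹-resp : ∀ {u v} → u ≈ v → ∀ c → act⁻¹ u c ≗ act⁻¹ v c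
  act⁻¹-resp {u} {v} (mk≈ u≈v) c k = begin
    act⁻¹ u c k                         ≡⟨ act-cong (reverse u) (λ k → sym (act-act⁻¹ v c k)) k ⟩
    act⁻¹ u (act M v (act⁻¹ v c)) k     ≡⟨ act-cong (reverse u) (λ k → sym (u≈v (act⁻¹ v c) k)) k ⟩
    act⁻¹ u (act M u (act⁻¹ v c)) k     ≡⟨ act⁻¹-act u (act⁻¹ v c) k ⟩
    act⁻¹ v c k                         ∎
    where open ≡-Reasoning

  ≈-by-basis : ∀ {u v} → (∀ j → act M u (δ j) ≗ act M v (δ j)) → u ≈ v
  ≈-by-basis {u} {v} agree = mk≈ λ c k → begin
    act M u c k                                   ≡⟨ act-cong u (basis-expansion c) k ⟩
    act M u (λ k → sum (λ j → c j * δ j k)) k     ≡⟨ act-sum u (λ j → c j ⊛ δ j) k ⟩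
    sum (λ j → act M u (c j ⊛ δ j) k)             ≡⟨ sum-cong-≗ (λ j → on-basis (c j) j k) ⟩
    sum (λ j → act M v (c j ⊛ δ j) k)             ≡⟨ act-sum v (λ j → c j ⊛ δ j) k ⟨
    act M v (λ k → sum (λ j → c j * δ j k)) k     ≡⟨ act-cong v (basis-expansion c) k ⟨
    act M v c k                                   ∎
    where
    open ≡-Reasoning
    on-basis : ∀ z j k → act M u (z ⊛ δ j) k ≡ act M v (z ⊛ δ j) k
    on-basis z j k = trans (act-⊛ u z (δ j) k) (trans (cong (z *_) (agree j k)) (sym (act-⊛ v z (δ j) k)))

  _≈?_ : ∀ u v → Dec (u ≈ v)
  u ≈? v = map′ (λ agree → ≈-by-basis agree) (λ u≈v j k → act-≈ u≈v (δ j) k)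
             (Finₚ.all? λ j → Finₚ.all? λ k → act M u (δ j) k ℤ.≟ act M v (δ j) k)

  ∃-word? : ∀ k {P : Word n → Set} → Decidable P → Dec (Σ (Word n) λ u → length u ≡ k × P u)
  ∃-word? zero    P? with P? []
  ... | yes P[] = yes ([] , refl , P[])
  ... | no ¬P[] = no λ { ([] , _ , P[]) → ¬P[] P[] }
  ∃-word? (suc k) P? with Finₚ.any? (λ i → ∃-word? k (P? ∘ (i ∷_)))
  ... | yes (i , u , |u|≡k , Piu) = yes (i ∷ u , cong suc |u|≡k , Piu)
  ... | no ∄ = no λ { (i ∷ u , |iu|≡sk , Piu) → ∄ (i , u , ℕₚ.suc-injective |iu|≡sk , Piu) }

  abstract
    ℓ-spec : ∀ w → Σ ℕ (IsLength M w)
    ℓ-spec w with minimal (λ k → ∃-word? k (_≈? w)) (length w) (w , refl , ≈-refl)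
    ... | m , (u , |u|≡m , u≈w) , below =
      m , (u , |u|≡m , act-≈ u≈w) , λ v v≈w → ℕₚ.≮⇒≥ λ |v|<m → below (length v) |v|<m (v , refl , mk≈ v≈w)

  ℓ : Word n → ℕ
  ℓ w = proj₁ (ℓ-spec w)

  ℓ-isLength : ∀ w → IsLength M w (ℓ w)
  ℓ-isLength w = proj₂ (ℓ-spec w)

  reducedWord : ∀ w → Σ (Word n) λ u → length u ≡ ℓ w × u ≈ w
  reducedWord w with proj₁ (ℓ-isLength w)
  ... | u , |u|≡ℓw , u≈w = u , |u|≡ℓw , mk≈ u≈w

  ℓ-minimal : ∀ {u w} → u ≈ w → ℓ w ≤ length u
  ℓ-minimal {u} {w} u≈w = proj₂ (ℓ-isLength w) u (act-≈ u≈w)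

  IsLength⇒≡ℓ : ∀ {w m} → IsLength M w m → m ≡ ℓ w
  IsLength⇒≡ℓ {w} {m} ((u , |u|≡m , u≈w) , m-min) with reducedWord w
  ... | v , |v|≡ℓw , v≈w =
    ℕₚ.≤-antisym (subst (m ≤_) |v|≡ℓw (m-min v (act-≈ v≈w))) (subst (ℓ w ≤_) |u|≡m (ℓ-minimal {u} (mk≈ u≈w)))

  IsLength-resp : ∀ {u w m} → u ≈ w → IsLength M u m → IsLength M w m
  IsLength-resp u≈w ((x , |x|≡m , x≈u) , m-min) =
    (x , |x|≡m , act-≈ (≈-trans {x} (mk≈ x≈u) u≈w)) ,
    λ y y≈w → m-min y (act-≈ (≈-trans {y} (mk≈ y≈w) (≈-sym u≈w)))

  ℓ-resp : ∀ {u w} → u ≈ w → ℓ u ≡ ℓ w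
  ℓ-resp {u} {w} u≈w = IsLength⇒≡ℓ {w} (IsLength-resp u≈w (ℓ-isLength u))

  ℓ≤length : ∀ w → ℓ w ≤ length w
  ℓ≤length w = ℓ-minimal {w} ≈-refl

  ℓ-++ : ∀ z v → ℓ (z ++ v) ≤ length z ℕ.+ ℓ v
  ℓ-++ z v with reducedWord v
  ... | r , |r|≡ℓv , r≈v =
    subst (ℓ (z ++ v) ≤_) (trans (Listₚ.length-++ z) (cong (length z ℕ.+_) |r|≡ℓv))
          (ℓ-minimal (++-cong (≈-refl {z}) r≈v))

  ℓ-≈-++ : ∀ {w} z v → w ≈ z ++ v → ℓ w ≤ length z ℕ.+ ℓ v
  ℓ-≈-++ {w} z v w≈zv = subst (_≤ length z ℕ.+ ℓ v) (ℓ-resp (≈-sym w≈zv)) (ℓ-++ z v)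

  split-ascent : ∀ {w} z t v → w ≈ z ++ (t ∷ v) → suc (length z) ℕ.+ ℓ v ≡ ℓ w → ℓ v ≤ ℓ (t ∷ v)
  split-ascent {w} z t v w≈ztv ℓ≡ = ℕₚ.≮⇒≥ λ ℓtv<ℓv → ℕₚ.<-irrefl refl (begin-strict
    ℓ w                         ≤⟨ ℓ-≈-++ z (t ∷ v) w≈ztv ⟩
    length z ℕ.+ ℓ (t ∷ v)      <⟨ ℕₚ.+-monoʳ-< (length z) ℓtv<ℓv ⟩
    length z ℕ.+ ℓ v            <⟨ ℕₚ.n<1+n (length z ℕ.+ ℓ v) ⟩
    suc (length z) ℕ.+ ℓ v      ≡⟨ ℓ≡ ⟩
    ℓ w                         ∎)
    where open ℕₚ.≤-Reasoning

  ℓ-∷ : ∀ t v → ℓ (t ∷ v) ≤ suc (ℓ v)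
  ℓ-∷ t v = ℓ-++ [ t ] v

  ℓ-∷⁻ : ∀ t v → ℓ v ≤ suc (ℓ (t ∷ v))
  ℓ-∷⁻ t v = subst (_≤ suc (ℓ (t ∷ v))) (ℓ-resp (s²≈id t v)) (ℓ-∷ t (t ∷ v))

  reduced-head-descent : ∀ {u j r} → j ∷ r ≈ u → length (j ∷ r) ≡ ℓ u → ℓ (j ∷ u) < ℓ u
  reduced-head-descent {u} {j} {r} jr≈u |jr|≡ℓu =
    subst (ℓ (j ∷ u) <_) |jr|≡ℓu (s≤s (ℓ-minimal (≈-trans (≈-sym (s²≈id j r)) (∷-cong j jr≈u))))

  Orthogonal : Word n → Set
  Orthogonal L = ∀ {j k} → j ∈ L → k ∈ L → j ≢ k → M j k ≡ + 0

  act-orthogonal : ∀ L → Unique L → Orthogonal L → ∀ c l →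
                   (l ∈ L → act M L c l ≡ c l - ⟪ l , c ⟫) × (l ∉ L → act M L c l ≡ c l)
  act-orthogonal []      _            _    c l = (λ ()) , λ _ → refl
  act-orthogonal (j ∷ L) (j∉L′ ∷ uniq) orth c l = on-block , off-block
    where
    j∉L : j ∉ L
    j∉L j∈L = All.lookup j∉L′ j∈L refl
    ih : ∀ l → (l ∈ L → act M L c l ≡ c l - ⟪ l , c ⟫) × (l ∉ L → act M L c l ≡ c l)
    ih = act-orthogonal L uniq (λ j∈L k∈L → orth (there j∈L) (there k∈L)) c
    d = act M L c
    ⟪j,d⟫ : ⟪ j , d ⟫ ≡ ⟪ j , c ⟫
    ⟪j,d⟫ = sum-cong-≗ term
      where
      term : ∀ m → M j m * d m ≡ M j m * c m
      term m with Any.any? (m ≟_) L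
      ... | yes m∈L = trans (cong (_* d m) Mjm≡0) (sym (cong (_* c m) Mjm≡0))
        where Mjm≡0 = orth (here refl) (there m∈L) (λ j≡m → j∉L (subst (_∈ L) (sym j≡m) m∈L))
      ... | no m∉L  = cong (M j m *_) (proj₂ (ih m) m∉L)
    sref-j-off : ∀ l → l ≢ j → sref M j d l ≡ d l
    sref-j-off l l≢j = trans (sref-≡ j d l) (trans (cong (λ x → d l - ⟪ j , d ⟫ * x) (δ-off l≢j)) (lemma (d l) ⟪ j , d ⟫))
      where
      lemma : ∀ a x → a - x * + 0 ≡ a
      lemma = solve-∀
    on-block : l ∈ j ∷ L → act M (j ∷ L) c l ≡ c l - ⟪ l , c ⟫
    on-block (here refl) = begin
      sref M j d j                 ≡⟨ sref-≡ j d j ⟩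
      d j - ⟪ j , d ⟫ * δ j j      ≡⟨ cong₂ (λ a x → a - x * δ j j) (proj₂ (ih j) j∉L) ⟪j,d⟫ ⟩
      c j - ⟪ j , c ⟫ * δ j j      ≡⟨ cong (λ e → c j - ⟪ j , c ⟫ * e) (δ-diag j) ⟩
      c j - ⟪ j , c ⟫ * + 1        ≡⟨ cong (_-_ (c j)) (ℤₚ.*-identityʳ ⟪ j , c ⟫) ⟩
      c j - ⟪ j , c ⟫              ∎
      where open ≡-Reasoning
    on-block (there l∈L) = trans (sref-j-off l (λ l≡j → j∉L (subst (_∈ L) l≡j l∈L))) (proj₁ (ih l) l∈L)
    off-block : l ∉ j ∷ L → act M (j ∷ L) c l ≡ c l
    off-block l∉jL = trans (sref-j-off l (l∉jL ∘ here)) (proj₂ (ih l) (l∉jL ∘ there))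

  act⁻¹-δ-fixed : ∀ L j → (∀ {l} → l ∈ L → M l j ≡ + 0) → act⁻¹ L (δ j) ≗ δ j
  act⁻¹-δ-fixed []      j _    k = refl
  act⁻¹-δ-fixed (l ∷ L) j ⊥L k = begin
    act⁻¹ (l ∷ L) (δ j) k         ≡⟨ cong-app (act⁻¹-∷ l L (δ j)) k ⟩
    act⁻¹ L (sref M l (δ j)) k    ≡⟨ act-cong (reverse L) sref-l-fixes k ⟩
    act⁻¹ L (δ j) k               ≡⟨ act⁻¹-δ-fixed L j (⊥L ∘ there) k ⟩
    δ j k                         ∎
    where
    open ≡-Reasoning
    sref-l-fixes : sref M l (δ j) ≗ δ j
    sref-l-fixes k = trans (sref-≡ l (δ j) k) (trans (cong (λ x → δ j k - x * δ l k) (trans (⟪⟫-δ l j) (⊥L (here refl))))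
                                                     (lemma (δ j k) (δ l k)))
      where
      lemma : ∀ a e → a - + 0 * e ≡ a
      lemma = solve-∀

  s-injective : ∀ j k x → j ∷ x ≈ k ∷ x → j ≡ k
  s-injective j k x jx≈kx with j ≟ k
  ... | yes j≡k = j≡k
  ... | no j≢k = contradiction (trans (sym sⱼ) (trans (act-≈ jx≈kx c j) sₖ)) λ ()
    where
    c = act⁻¹ x (δ j)
    sⱼ : sref M j (act M x c) j ≡ - + 1
    sⱼ = trans (sref-cong j (act-act⁻¹ x (δ j)) j) (trans (sref-δ-self j j) (cong (λ e → - + 1 * e) (δ-diag j)))
    sₖ : sref M k (act M x c) j ≡ + 1
    sₖ = trans (sref-cong k (act-act⁻¹ x (δ j)) j)
           (trans (sref-≡ k (δ j) j) (trans (cong₂ (λ a e → a - ⟪ k , δ j ⟫ * e) (δ-diag j) (δ-off j≢k)) (lemma ⟪ k , δ j ⟫)))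
      where
      lemma : ∀ x → + 1 - x * + 0 ≡ + 1
      lemma = solve-∀

  ascent⇒Cover : ∀ {w s} → ℓ w < ℓ (s ∷ w) → Cover M w s
  ascent⇒Cover {w} {s} ℓw<ℓsw =
    ℓ w , ℓ-isLength w , subst (IsLength M (s ∷ w)) (ℕₚ.≤-antisym (ℓ-∷ s w) ℓw<ℓsw) (ℓ-isLength (s ∷ w))

  Cover⇒ascent : ∀ {w s} → Cover M w s → ℓ w < ℓ (s ∷ w)
  Cover⇒ascent {w} {s} (m , w-length , sw-length) =
    subst₂ _<_ (IsLength⇒≡ℓ w-length) (IsLength⇒≡ℓ sw-length) (ℕₚ.n<1+n m)

  Cover-resp : ∀ {v x s} → v ≈ x → Cover M v s → Cover M x s
  Cover-resp {s = s} v≈x (m , v-length , sv-length) = m , IsLength-resp v≈x v-length , IsLength-resp (∷-cong s v≈x) sv-length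

  act⁻¹-∷-δ-self : ∀ w s → act⁻¹ (s ∷ w) (δ s) ≗ (- + 1) ⊛ act⁻¹ w (δ s)
  act⁻¹-∷-δ-self w s k = trans (cong-app (act⁻¹-∷ s w (δ s)) k)
                           (trans (act-cong (reverse w) (sref-δ-self s) k) (act-⊛ (reverse w) (- + 1) (δ s) k))

  act⁻¹-δ-¬≥𝟎∧≤𝟎 : ∀ w s → act⁻¹ w (δ s) ≥𝟎 → act⁻¹ w (δ s) ≤𝟎 → ⊥
  act⁻¹-δ-¬≥𝟎∧≤𝟎 w s ≥0 ≤0 = contradiction 1≡0 λ ()
    where
    open ≡-Reasoning
    1≡0 : + 1 ≡ + 0
    1≡0 = begin
      + 1                          ≡⟨ δ-diag s ⟨
      δ s s                        ≡⟨ act-act⁻¹ w (δ s) s ⟨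
      act M w (act⁻¹ w (δ s)) s    ≡⟨ act-cong w (λ k → ℤₚ.≤-antisym (≤0 k) (≥0 k)) s ⟩
      act M w 𝟎 s                  ≡⟨ act-𝟎 w s ⟩
      + 0                          ∎

alt : ∀ {n} → ℕ → Fin n → Fin n → Word n
alt zero    t u = []
alt (suc k) t u = t ∷ alt k u t

altAt : ∀ {n} → ℕ → Fin n → Fin n → Fin n
altAt zero    t u = t
altAt (suc k) t u = altAt k u t

alt-suc : ∀ {n} k (t u : Fin n) → alt (suc k) t u ≡ alt k t u ++ [ altAt k t u ]
alt-suc zero    t u = refl
alt-suc (suc k) t u = cong (t ∷_) (alt-suc k u t)

altAt-cases : ∀ {n} k (t u : Fin n) →
  (altAt k t u ≡ t × altAt k u t ≡ u) ⊎ (altAt k t u ≡ u × altAt k u t ≡ t)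
altAt-cases zero    t u = inj₁ (refl , refl)
altAt-cases (suc k) t u with altAt-cases k u t
... | inj₁ (e₁ , e₂) = inj₂ (e₁ , e₂)
... | inj₂ (e₁ , e₂) = inj₁ (e₁ , e₂)

length-alt : ∀ {n} k (t u : Fin n) → length (alt k t u) ≡ k
length-alt zero    t u = refl
length-alt (suc k) t u = cong suc (length-alt k u t)

alt-suc-++ : ∀ {n} k (t u : Fin n) v → alt (suc k) t u ++ v ≡ alt k t u ++ (altAt k t u ∷ v)
alt-suc-++ k t u v = trans (cong (_++ v) (alt-suc k t u)) (Listₚ.++-assoc (alt k t u) [ altAt k t u ] v)

-- alt k t u acts by c ↦ c + (p₁ ⟪t,c⟫ + p₂ ⟪u,c⟫) α_t + (q₁ ⟪t,c⟫ + q₂ ⟪u,c⟫) α_u, where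
-- ((p₁ , p₂) , (q₁ , q₂)) = altCoeffs k a_tu a_ut; a braid relation is thus an identity of integer
-- 2×2 matrices that can be checked by evaluation.
Coeffs₂ : Set
Coeffs₂ = (ℤ × ℤ) × (ℤ × ℤ)

stepCoeffs : ℤ → Coeffs₂ → Coeffs₂
stepCoeffs a ((p₁ , p₂) , (q₁ , q₂)) = (- q₂ - + 1 - a * p₂ , - q₁ - a * p₁) , (p₂ , p₁)

altCoeffs : ℕ → ℤ → ℤ → Coeffs₂
altCoeffs zero    a b = (+ 0 , + 0) , (+ 0 , + 0)
altCoeffs (suc k) a b = stepCoeffs a (altCoeffs k b a)

swapCoeffs : Coeffs₂ → Coeffs₂
swapCoeffs ((p₁ , p₂) , (q₁ , q₂)) = (q₂ , q₁) , (p₂ , p₁)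

nonpos⇒neg : ∀ {z} → z ℤ.≤ + 0 → Σ ℕ λ x → z ≡ - + x
nonpos⇒neg {+ zero}   _ = 0 , refl
nonpos⇒neg {+ suc _}  (ℤ.+≤+ ())
nonpos⇒neg { -[1+ x ]} _ = suc x , refl

rank2Coeffs : ℕ → ℤ → ℤ → ℤ × ℤ → ℤ × ℤ
rank2Coeffs zero    a b pq      = pq
rank2Coeffs (suc k) a b (p , q) = rank2Coeffs k b a (- q - a * p , p)

NonNeg : ℤ × ℤ → Set
NonNeg (p , q) = + 0 ℤ.≤ p × + 0 ℤ.≤ q

nonneg? : ∀ pq → Dec (NonNeg pq)
nonneg? (p , q) = (+ 0 ℤ.≤? p) ×-dec (+ 0 ℤ.≤? q)

rank2-growth : ∀ x y p q → 4 ≤ x ℕ.* y → 2 ℕ.* q ≤ x ℕ.* p → 2 ℕ.* p ≤ y ℕ.* (x ℕ.* p ∸ q)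
rank2-growth x y p q 4≤xy 2q≤xp = ℕₚ.*-cancelˡ-≤ 2 (begin
  2 ℕ.* (2 ℕ.* p)              ≡⟨ ℕₚ.*-assoc 2 2 p ⟨
  4 ℕ.* p                      ≤⟨ ℕₚ.*-monoˡ-≤ p 4≤xy ⟩
  x ℕ.* y ℕ.* p                ≡⟨ lemma₁ x y p ⟩
  y ℕ.* (x ℕ.* p)              ≡⟨ cong (y ℕ.*_) (ℕₚ.m+[n∸m]≡n q≤xp) ⟨
  y ℕ.* (q ℕ.+ r)              ≤⟨ ℕₚ.*-monoʳ-≤ y (ℕₚ.+-monoˡ-≤ r q≤r) ⟩
  y ℕ.* (r ℕ.+ r)              ≡⟨ lemma₂ y r ⟩
  2 ℕ.* (y ℕ.* r)              ∎)
  where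
  open ℕₚ.≤-Reasoning
  r = x ℕ.* p ∸ q
  q≤xp : q ≤ x ℕ.* p
  q≤xp = ℕₚ.≤-trans (ℕₚ.m≤n*m q 2) 2q≤xp
  q≤r : q ≤ r
  q≤r = ℕₚ.+-cancelˡ-≤ q q r (subst (q ℕ.+ q ≤_) (sym (ℕₚ.m+[n∸m]≡n q≤xp))
          (subst (_≤ x ℕ.* p) (cong (q ℕ.+_) (ℕₚ.+-identityʳ q)) 2q≤xp))
  lemma₁ : ∀ x y p → x ℕ.* y ℕ.* p ≡ y ℕ.* (x ℕ.* p)
  lemma₁ = ℕSolver.solve-∀
  lemma₂ : ∀ y r → y ℕ.* (r ℕ.+ r) ≡ 2 ℕ.* (y ℕ.* r)
  lemma₂ = ℕSolver.solve-∀

-- For x y ≥ 4 the dihedral group is infinite and the invariant 2 q ≤ x p keeps all coefficients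
-- nonnegative.
rank2Coeffs-nonneg : ∀ k x y p q → 4 ≤ x ℕ.* y → 2 ℕ.* q ≤ x ℕ.* p →
                     NonNeg (rank2Coeffs k (- + x) (- + y) (+ p , + q))
rank2Coeffs-nonneg zero    x y p q _ _ = ℤ.+≤+ z≤n , ℤ.+≤+ z≤n
rank2Coeffs-nonneg (suc k) x y p q 4≤xy 2q≤xp =
  subst (λ z → NonNeg (rank2Coeffs k (- + y) (- + x) (z , + p))) (sym next≡)
        (rank2Coeffs-nonneg k y x (x ℕ.* p ∸ q) p (subst (4 ≤_) (ℕₚ.*-comm x y) 4≤xy) (rank2-growth x y p q 4≤xy 2q≤xp))
  where
  open ≡-Reasoning
  lemma : ∀ q x p → - q - (- x) * p ≡ x * p - q
  lemma = solve-∀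
  next≡ : - + q - (- + x) * + p ≡ + (x ℕ.* p ∸ q)
  next≡ = begin
    - + q - (- + x) * + p     ≡⟨ lemma (+ q) (+ x) (+ p) ⟩
    + x * + p - + q           ≡⟨ cong (_- + q) (ℤₚ.pos-* x p) ⟨
    + (x ℕ.* p) - + q         ≡⟨ ℤₚ.m-n≡m⊖n (x ℕ.* p) q ⟩
    x ℕ.* p ⊖ q               ≡⟨ ℤₚ.⊖-≥ (ℕₚ.≤-trans (ℕₚ.m≤n*m q 2) 2q≤xp) ⟩
    + (x ℕ.* p ∸ q)           ∎

module Dihedral {n : ℕ} (M : Matrix n) (M-diag : ∀ i → M i i ≡ + 2) where
  open Reflections M M-diag public

  rank2Action : Fin n → Fin n → Coeffs₂ → Lattice n → Lattice n
  rank2Action t u ((p₁ , p₂) , (q₁ , q₂)) c =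
    c ⊕ (p₁ * ⟪ t , c ⟫ + p₂ * ⟪ u , c ⟫) ⊛ δ t ⊕ (q₁ * ⟪ t , c ⟫ + q₂ * ⟪ u , c ⟫) ⊛ δ u

  sref-rank2Action : ∀ t u g c → sref M t (rank2Action u t g c) ≗ rank2Action t u (stepCoeffs (M t u) g) c
  sref-rank2Action t u ((p₁ , p₂) , (q₁ , q₂)) c k = begin
    sref M t d k                                ≡⟨ sref-≡ t d k ⟩
    d k - ⟪ t , d ⟫ * δ t k                     ≡⟨ cong (λ z → d k - z * δ t k) ⟪t,d⟫ ⟩
    d k - (x + P * M t u + Q * + 2) * δ t k     ≡⟨ lemma (c k) x y (δ t k) (δ u k) (M t u) p₁ p₂ q₁ q₂ ⟩
    rank2Action t u (stepCoeffs (M t u) ((p₁ , p₂) , (q₁ , q₂))) c k ∎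
    where
    open ≡-Reasoning
    d = rank2Action u t ((p₁ , p₂) , (q₁ , q₂)) c
    x = ⟪ t , c ⟫
    y = ⟪ u , c ⟫
    P = p₁ * y + p₂ * x
    Q = q₁ * y + q₂ * x
    ⟪t,d⟫ : ⟪ t , d ⟫ ≡ x + P * M t u + Q * + 2
    ⟪t,d⟫ = begin
      ⟪ t , c ⊕ P ⊛ δ u ⊕ Q ⊛ δ t ⟫               ≡⟨ ⟪⟫-⊕ t (c ⊕ P ⊛ δ u) (Q ⊛ δ t) ⟩
      ⟪ t , c ⊕ P ⊛ δ u ⟫ + ⟪ t , Q ⊛ δ t ⟫       ≡⟨ cong₂ _+_ (⟪⟫-⊕ t c (P ⊛ δ u)) (⟪⟫-⊛ t Q (δ t)) ⟩
      x + ⟪ t , P ⊛ δ u ⟫ + Q * ⟪ t , δ t ⟫       ≡⟨ cong₂ (λ a b → x + a + Q * b) (⟪⟫-⊛ t P (δ u)) (trans (⟪⟫-δ t t) (M-diag t)) ⟩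
      x + P * ⟪ t , δ u ⟫ + Q * + 2               ≡⟨ cong (λ a → x + P * a + Q * + 2) (⟪⟫-δ t u) ⟩
      x + P * M t u + Q * + 2                     ∎
    lemma : ∀ c x y dt du a p₁ p₂ q₁ q₂ →
      c + (p₁ * y + p₂ * x) * du + (q₁ * y + q₂ * x) * dt
        - (x + (p₁ * y + p₂ * x) * a + (q₁ * y + q₂ * x) * + 2) * dt
      ≡ c + ((- q₂ - + 1 - a * p₂) * x + (- q₁ - a * p₁) * y) * dt + (p₂ * x + p₁ * y) * du
    lemma = solve-∀

  act-alt : ∀ k t u c → act M (alt k t u) c ≗ rank2Action t u (altCoeffs k (M t u) (M u t)) c
  act-alt zero    t u c k = lemma (c k) ⟪ t , c ⟫ ⟪ u , c ⟫ (δ t k) (δ u k)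
    where
    lemma : ∀ c x y dt du → c ≡ c + (+ 0 * x + + 0 * y) * dt + (+ 0 * x + + 0 * y) * du
    lemma = solve-∀
  act-alt (suc k) t u c k′ =
    trans (sref-cong t (act-alt k u t c) k′) (sref-rank2Action t u (altCoeffs k (M u t) (M t u)) c k′)

  braid-relation : ∀ m t u → altCoeffs m (M t u) (M u t) ≡ swapCoeffs (altCoeffs m (M u t) (M t u)) →
                   alt m t u ≈ alt m u t
  braid-relation m t u coeffs≡ = mk≈ λ c k → begin
    act M (alt m t u) c k                                      ≡⟨ act-alt m t u c k ⟩
    rank2Action t u (altCoeffs m (M t u) (M u t)) c k          ≡⟨ cong (λ g → rank2Action t u g c k) coeffs≡ ⟩
    rank2Action t u (swapCoeffs (altCoeffs m (M u t) (M t u))) c k ≡⟨ swap-action (altCoeffs m (M u t) (M t u)) c k ⟩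
    rank2Action u t (altCoeffs m (M u t) (M t u)) c k          ≡⟨ act-alt m u t c k ⟨
    act M (alt m u t) c k                                      ∎
    where
    open ≡-Reasoning
    swap-action : ∀ g c → rank2Action t u (swapCoeffs g) c ≗ rank2Action u t g c
    swap-action ((p₁ , p₂) , (q₁ , q₂)) c k = lemma (c k) ⟪ t , c ⟫ ⟪ u , c ⟫ (δ t k) (δ u k) p₁ p₂ q₁ q₂
      where
      lemma : ∀ c x y dt du p₁ p₂ q₁ q₂ →
        c + (q₂ * x + q₁ * y) * dt + (p₂ * x + p₁ * y) * du ≡ c + (p₁ * y + p₂ * x) * du + (q₁ * y + q₂ * x) * dt
      lemma = solve-∀

  Cone : Fin n → Fin n → Lattice n → Set
  Cone t u v = Σ ℤ λ p → Σ ℤ λ q → + 0 ℤ.≤ p × + 0 ℤ.≤ q × v ≗ p ⊛ δ t ⊕ q ⊛ δ u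

  Cone-swap : ∀ {t u v} → Cone t u v → Cone u t v
  Cone-swap {t} {u} (p , q , 0≤p , 0≤q , v≗) =
    q , p , 0≤q , 0≤p , λ k → trans (v≗ k) (ℤₚ.+-comm (p * δ t k) (q * δ u k))

  Cone-resp : ∀ {t u v w} → v ≗ w → Cone t u v → Cone t u w
  Cone-resp v≗w (p , q , 0≤p , 0≤q , v≗) = p , q , 0≤p , 0≤q , λ k → trans (sym (v≗w k)) (v≗ k)

  sref-rank2 : ∀ t u p q → sref M t (p ⊛ δ u ⊕ q ⊛ δ t) ≗ (- q - M t u * p) ⊛ δ t ⊕ p ⊛ δ u
  sref-rank2 t u p q k = begin
    sref M t v k                                ≡⟨ sref-≡ t v k ⟩
    v k - ⟪ t , v ⟫ * δ t k                     ≡⟨ cong (λ x → v k - x * δ t k) ⟪t,v⟫ ⟩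
    v k - (p * M t u + q * + 2) * δ t k         ≡⟨ lemma p q (M t u) (δ u k) (δ t k) ⟩
    (- q - M t u * p) * δ t k + p * δ u k       ∎
    where
    open ≡-Reasoning
    v = p ⊛ δ u ⊕ q ⊛ δ t
    ⟪t,v⟫ : ⟪ t , v ⟫ ≡ p * M t u + q * + 2
    ⟪t,v⟫ = trans (⟪⟫-⊕ t (p ⊛ δ u) (q ⊛ δ t))
              (cong₂ _+_ (trans (⟪⟫-⊛ t p (δ u)) (cong (p *_) (⟪⟫-δ t u)))
                         (trans (⟪⟫-⊛ t q (δ t)) (cong (q *_) (trans (⟪⟫-δ t t) (M-diag t)))))
    lemma : ∀ p q a du dt → p * du + q * dt - (p * a + q * + 2) * dt ≡ (- q - a * p) * dt + p * du
    lemma = solve-∀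

  Cone-alt : ∀ k t u p q → NonNeg (rank2Coeffs k (M t u) (M u t) (p , q)) →
             Cone t u (act⁻¹ (alt k t u) (p ⊛ δ u ⊕ q ⊛ δ t))
  Cone-alt zero    t u p q (0≤p , 0≤q) = Cone-swap (p , q , 0≤p , 0≤q , λ _ → refl)
  Cone-alt (suc k) t u p q nonneg =
    Cone-swap (Cone-resp shift (Cone-alt k u t (- q - M t u * p) p nonneg))
    where
    shift : act⁻¹ (alt k u t) ((- q - M t u * p) ⊛ δ t ⊕ p ⊛ δ u) ≗ act⁻¹ (alt (suc k) t u) (p ⊛ δ u ⊕ q ⊛ δ t)
    shift k′ = sym (trans (cong-app (act⁻¹-∷ t (alt k u t) _) k′)
                     (act-cong (reverse (alt k u t)) (sref-rank2 t u p q) k′))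

  Collapses : ℕ → Fin n → Fin n → Set
  Collapses k t u = Σ (Word n) λ z → length z < k × (alt k t u ≈ z ⊎ alt k t u ≈ u ∷ z)

  Collapses-suc : ∀ k t u → Collapses k u t → Collapses (suc k) t u
  Collapses-suc k t u (z , |z|<k , inj₁ alt≈z)  = t ∷ z , s≤s |z|<k , inj₁ (∷-cong t alt≈z)
  Collapses-suc k t u (z , |z|<k , inj₂ alt≈tz) =
    z , ℕₚ.m≤n⇒m≤1+n |z|<k , inj₁ (≈-trans (∷-cong t alt≈tz) (s²≈id t z))

  braid⇒collapses : ∀ m t u → alt (suc m) t u ≈ alt (suc m) u t →
                    ∀ d → Collapses (suc m ℕ.+ d) t u × Collapses (suc m ℕ.+ d) u t
  braid⇒collapses m t u braid zero =
    subst (λ k → Collapses k t u × Collapses k u t) (sym (ℕₚ.+-identityʳ (suc m)))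
          (braid-collapses t u braid , braid-collapses u t (≈-sym braid))
    where
    braid-collapses : ∀ t u → alt (suc m) t u ≈ alt (suc m) u t → Collapses (suc m) t u
    braid-collapses t u braid = alt m t u , s≤s (ℕₚ.≤-reflexive (length-alt m t u)) , inj₂ braid
  braid⇒collapses m t u braid (suc d) with braid⇒collapses m t u braid d
  ... | collapses-tu , collapses-ut =
    subst (λ k → Collapses k t u × Collapses k u t) (sym (ℕₚ.+-suc (suc m) d))
          (Collapses-suc _ t u collapses-ut , Collapses-suc _ u t collapses-tu)

  Cone-alt-δ : ∀ k s s' → NonNeg (rank2Coeffs k (M s' s) (M s s') (+ 1 , + 0)) →
               Cone s' s (act⁻¹ (alt k s' s) (δ s))
  Cone-alt-δ k s s' nonneg = Cone-resp (act-cong (reverse (alt k s' s)) δ≗) (Cone-alt k s' s (+ 1) (+ 0) nonneg)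
    where
    δ≗ : + 1 ⊛ δ s ⊕ + 0 ⊛ δ s' ≗ δ s
    δ≗ j = lemma (δ s j) (δ s' j)
      where
      lemma : ∀ a b → + 1 * a + + 0 * b ≡ a
      lemma = solve-∀

  -- For a_{s's} a_{ss'} < 4 the product s' s has order m ∈ {2,3,4,6}: the braid relation of length m
  -- and the positivity of the first m coefficients are checked by evaluation, and every longer
  -- alternating word collapses.
  dihedral-cone-finite : ∀ {s s' a b} m → 1 ≤ m → M s' s ≡ a → M s s' ≡ b →
    altCoeffs m a b ≡ swapCoeffs (altCoeffs m b a) →
    True (ℕₚ.allUpTo? (λ k → nonneg? (rank2Coeffs k a b (+ 1 , + 0))) m) →
    ∀ k → ¬ Collapses k s' s → Cone s' s (act⁻¹ (alt k s' s) (δ s))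
  dihedral-cone-finite {s} {s'} (suc m) _ refl refl coeffs≡ nonneg k ¬collapses with k ℕₚ.<? suc m
  ... | yes k<m = Cone-alt-δ k s s' (toWitness nonneg k<m)
  ... | no k≮m with ℕₚ.m≤n⇒∃[o]m+o≡n (ℕₚ.≮⇒≥ k≮m)
  ...   | d , refl = ⊥-elim (¬collapses (proj₁ (braid⇒collapses m s' s (braid-relation (suc m) s' s coeffs≡) d)))

  dihedral-cone-infinite : ∀ {s s'} x y → M s' s ≡ - + x → M s s' ≡ - + y → 4 ≤ x ℕ.* y →
    ∀ k → Cone s' s (act⁻¹ (alt k s' s) (δ s))
  dihedral-cone-infinite {s} {s'} x y a≡ b≡ 4≤xy k =
    Cone-alt-δ k s s' (subst₂ (λ a b → NonNeg (rank2Coeffs k a b (+ 1 , + 0))) (sym a≡) (sym b≡)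
                              (rank2Coeffs-nonneg k x y 1 0 4≤xy z≤n))

  Cone-act⁻¹-≥𝟎 : ∀ {t u c} v → Cone t u c → act⁻¹ v (δ t) ≥𝟎 → act⁻¹ v (δ u) ≥𝟎 → act⁻¹ v c ≥𝟎
  Cone-act⁻¹-≥𝟎 {t} {u} {c} v (p , q , 0≤p , 0≤q , c≗) t≥0 u≥0 k =
    subst (+ 0 ℤ.≤_) (sym act⁻¹v[c]≡)
          (ℤₚ.+-mono-≤ (*-nonneg 0≤p (t≥0 k)) (*-nonneg 0≤q (u≥0 k)))
    where
    act⁻¹v[c]≡ : act⁻¹ v c k ≡ p * act⁻¹ v (δ t) k + q * act⁻¹ v (δ u) k
    act⁻¹v[c]≡ = trans (act-cong (reverse v) c≗ k)
                   (trans (act-⊕ (reverse v) (p ⊛ δ t) (q ⊛ δ u) k)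
                          (cong₂ _+_ (act-⊛ (reverse v) p (δ t) k) (act-⊛ (reverse v) q (δ u) k)))

  record DihedralFactorisation (w : Word n) (s s' : Fin n) : Set where
    field
      k         : ℕ
      v         : Word n
      1≤k       : 1 ≤ k
      w≈alt++v  : w ≈ alt k s' s ++ v
      ℓ-splits  : k ℕ.+ ℓ v ≡ ℓ w
      ascent-s  : ℓ v ≤ ℓ (s ∷ v)
      ascent-s' : ℓ v ≤ ℓ (s' ∷ v)

  dihedral-factorisation : ∀ {w} s s' r → s' ∷ r ≈ w → length (s' ∷ r) ≡ ℓ w → DihedralFactorisation w s s'
  dihedral-factorisation {w} s s' r s'r≈w |s'r|≡ℓw =
    extend 0 r (<-wellFounded (ℓ r)) (≈-sym s'r≈w) (trans (cong suc ℓr≡|r|) |s'r|≡ℓw)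
    where
    ℓr≡|r| : ℓ r ≡ length r
    ℓr≡|r| = ℕₚ.≤-antisym (ℓ≤length r)
               (ℕₚ.≤-pred (subst (_≤ suc (ℓ r)) (trans (ℓ-resp s'r≈w) (sym |s'r|≡ℓw)) (ℓ-∷ s' r)))
    both-ascents : ∀ {v t t₀} → (t ≡ s × t₀ ≡ s') ⊎ (t ≡ s' × t₀ ≡ s) →
                   ℓ v ≤ ℓ (t ∷ v) → ℓ v ≤ ℓ (t₀ ∷ v) → ℓ v ≤ ℓ (s ∷ v) × ℓ v ≤ ℓ (s' ∷ v)
    both-ascents (inj₁ (refl , refl)) t-ascent t₀-ascent = t-ascent , t₀-ascent
    both-ascents (inj₂ (refl , refl)) t-ascent t₀-ascent = t₀-ascent , t-ascent
    extend : ∀ k v → Acc _<_ (ℓ v) → w ≈ alt (suc k) s' s ++ v → suc k ℕ.+ ℓ v ≡ ℓ w →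
             DihedralFactorisation w s s'
    extend k v (acc rs) w≈ ℓ≡ with ℓ v ℕₚ.≤? ℓ (altAt k s s' ∷ v)
    ... | no next-descent =
      extend (suc k) (t ∷ v) (rs ℓtv<ℓv) w≈′ (trans (sym (ℕₚ.+-suc (suc k) (ℓ (t ∷ v)))) (trans (cong (suc k ℕ.+_) (sym ℓv≡)) ℓ≡))
      where
      open ≈-Reasoning
      t = altAt k s s'
      ℓtv<ℓv : ℓ (t ∷ v) < ℓ v
      ℓtv<ℓv = ℕₚ.≰⇒> next-descent
      ℓv≡ : ℓ v ≡ suc (ℓ (t ∷ v))
      ℓv≡ = ℕₚ.≤-antisym (ℓ-∷⁻ t v) ℓtv<ℓv
      w≈′ : w ≈ alt (suc (suc k)) s' s ++ (t ∷ v)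
      w≈′ = begin
        w                                    ≈⟨ w≈ ⟩
        alt (suc k) s' s ++ v                ≈⟨ ++-cong (≈-refl {alt (suc k) s' s}) (s²≈id t v) ⟨
        alt (suc k) s' s ++ (t ∷ t ∷ v)      ≡⟨ alt-suc-++ (suc k) s' s (t ∷ v) ⟨
        alt (suc (suc k)) s' s ++ (t ∷ v)    ∎
    ... | yes next-ascent with both-ascents (altAt-cases k s s') next-ascent last-ascent
      where
      last-ascent : ℓ v ≤ ℓ (altAt k s' s ∷ v)
      last-ascent = split-ascent (alt k s' s) (altAt k s' s) v (≈-trans w≈ (≡⇒≈ (alt-suc-++ k s' s v)))
                      (trans (cong (λ m → suc m ℕ.+ ℓ v) (length-alt k s' s)) ℓ≡)
    ...   | ascent-s , ascent-s' = record
      { k = suc k ; v = v ; 1≤k = s≤s z≤n ; w≈alt++v = w≈ ; ℓ-splits = ℓ≡ ; ascent-s = ascent-s ; ascent-s' = ascent-s' }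

  factorisation-¬collapses : ∀ {w s s'} → ℓ w ≤ ℓ (s ∷ w) → (F : DihedralFactorisation w s s') →
                             ¬ Collapses (DihedralFactorisation.k F) s' s
  factorisation-¬collapses {w} {s} {s'} ℓw≤ℓsw F (z , |z|<k , collapse) = refute collapse
    where
    open DihedralFactorisation F
    shorter : ∀ {x} → x ≈ z ++ v → ℓ x < ℓ w
    shorter {x} x≈zv = ℕₚ.≤-<-trans (ℓ-≈-++ z v x≈zv) (subst (length z ℕ.+ ℓ v <_) ℓ-splits (ℕₚ.+-monoˡ-< (ℓ v) |z|<k))
    refute : alt k s' s ≈ z ⊎ alt k s' s ≈ s ∷ z → ⊥
    refute (inj₁ alt≈z)  = ℕₚ.<-irrefl refl (shorter (≈-trans w≈alt++v (++-cong alt≈z (≈-refl {v}))))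
    refute (inj₂ alt≈sz) = ℕₚ.<-irrefl refl (ℕₚ.<-≤-trans (shorter sw≈zv) ℓw≤ℓsw)
      where
      open ≈-Reasoning
      sw≈zv : s ∷ w ≈ z ++ v
      sw≈zv = begin
        s ∷ w                ≈⟨ ∷-cong s w≈alt++v ⟩
        s ∷ alt k s' s ++ v  ≈⟨ ∷-cong s (++-cong alt≈sz (≈-refl {v})) ⟩
        s ∷ s ∷ z ++ v       ≈⟨ s²≈id s (z ++ v) ⟩
        z ++ v               ∎

module PositiveRoots {n : ℕ} (M : Matrix n) (M-gcm : IsGCM M) where
  open IsGCM M-gcm
  open Dihedral M diag public

  dihedral-cone : ∀ s s' → s ≢ s' → ∀ k → ¬ Collapses k s' s → Cone s' s (act⁻¹ (alt k s' s) (δ s))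
  dihedral-cone s s' s≢s' with nonpos⇒neg (offdiag s' s (s≢s' ∘ sym)) | nonpos⇒neg (offdiag s s' s≢s')
  ... | x , a≡ | y , b≡ = by-type x y a≡ b≡
    where
    infinite-type : ∀ {x y} → M s' s ≡ - + x → M s s' ≡ - + y → 4 ≤ x ℕ.* y →
                    ∀ k → ¬ Collapses k s' s → Cone s' s (act⁻¹ (alt k s' s) (δ s))
    infinite-type {x} {y} a≡ b≡ 4≤xy k _ = dihedral-cone-infinite x y a≡ b≡ 4≤xy k
    by-type : ∀ x y → M s' s ≡ - + x → M s s' ≡ - + y →
              ∀ k → ¬ Collapses k s' s → Cone s' s (act⁻¹ (alt k s' s) (δ s))
    by-type 0 0 a≡ b≡ = dihedral-cone-finite 2 (s≤s z≤n) a≡ b≡ refl _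
    by-type 0 (suc y) a≡ b≡ with () ← trans (sym b≡) (zeroSym s' s a≡)
    by-type (suc x) 0 a≡ b≡ with () ← trans (sym a≡) (zeroSym s s' b≡)
    by-type 1 1 a≡ b≡ = dihedral-cone-finite 3 (s≤s z≤n) a≡ b≡ refl _
    by-type 1 2 a≡ b≡ = dihedral-cone-finite 4 (s≤s z≤n) a≡ b≡ refl _
    by-type 2 1 a≡ b≡ = dihedral-cone-finite 4 (s≤s z≤n) a≡ b≡ refl _
    by-type 1 3 a≡ b≡ = dihedral-cone-finite 6 (s≤s z≤n) a≡ b≡ refl _
    by-type 3 1 a≡ b≡ = dihedral-cone-finite 6 (s≤s z≤n) a≡ b≡ refl _
    by-type 1 (suc (suc (suc (suc y)))) a≡ b≡ = infinite-type a≡ b≡ (s≤s (s≤s (s≤s (s≤s z≤n))))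
    by-type (suc (suc (suc (suc x)))) 1 a≡ b≡ = infinite-type a≡ b≡ (s≤s (s≤s (s≤s (s≤s z≤n))))
    by-type (suc (suc x)) (suc (suc y)) a≡ b≡ =
      infinite-type a≡ b≡ (ℕₚ.*-mono-≤ {2} {2 ℕ.+ x} {2} {2 ℕ.+ y} (s≤s (s≤s z≤n)) (s≤s (s≤s z≤n)))

  act⁻¹-δ-≥𝟎 : ∀ w s → ℓ w ≤ ℓ (s ∷ w) → act⁻¹ w (δ s) ≥𝟎
  act⁻¹-δ-≥𝟎 w s = go w s (<-wellFounded (ℓ w))
    where
    go : ∀ w s → Acc _<_ (ℓ w) → ℓ w ≤ ℓ (s ∷ w) → act⁻¹ w (δ s) ≥𝟎
    go w s (acc rs) ℓw≤ℓsw with reducedWord w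
    ... | [] , _ , []≈w = ≥𝟎-resp (act⁻¹-resp []≈w (δ s)) (δ≥𝟎 s)
    ... | s' ∷ r , |s'r|≡ℓw , s'r≈w = ≥𝟎-resp (λ k → sym (act⁻¹w≡ k)) (Cone-act⁻¹-≥𝟎 v cone ih-s' ih-s)
      where
      s≢s' : s ≢ s'
      s≢s' refl = ℕₚ.<-irrefl refl (ℕₚ.≤-<-trans ℓw≤ℓsw (ℕₚ.≤-<-trans ℓsw≤|r| (ℕₚ.≤-reflexive |s'r|≡ℓw)))
        where
        ℓsw≤|r| : ℓ (s ∷ w) ≤ length r
        ℓsw≤|r| = ℓ-minimal (≈-trans (≈-sym (s²≈id s r)) (∷-cong s s'r≈w))
      F = dihedral-factorisation s s' r s'r≈w |s'r|≡ℓw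
      open DihedralFactorisation F
      v<w : ℓ v < ℓ w
      v<w = ℕₚ.<-≤-trans (ℕₚ.+-monoˡ-≤ (ℓ v) 1≤k) (ℕₚ.≤-reflexive ℓ-splits)
      ih-s : act⁻¹ v (δ s) ≥𝟎
      ih-s = go v s (rs v<w) ascent-s
      ih-s' : act⁻¹ v (δ s') ≥𝟎
      ih-s' = go v s' (rs v<w) ascent-s'
      cone : Cone s' s (act⁻¹ (alt k s' s) (δ s))
      cone = dihedral-cone s s' s≢s' k (factorisation-¬collapses ℓw≤ℓsw F)
      act⁻¹w≡ : act⁻¹ w (δ s) ≗ act⁻¹ v (act⁻¹ (alt k s' s) (δ s))
      act⁻¹w≡ k′ = trans (act⁻¹-resp w≈alt++v (δ s) k′) (cong-app (act⁻¹-++ (alt k s' s) v (δ s)) k′)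

  ascent⊎descent : ∀ w s → (ℓ w < ℓ (s ∷ w) × act⁻¹ w (δ s) ≥𝟎) ⊎ (ℓ (s ∷ w) < ℓ w × act⁻¹ w (δ s) ≤𝟎)
  ascent⊎descent w s with ℓ w ℕₚ.<? ℓ (s ∷ w)
  ... | yes ℓw<ℓsw = inj₁ (ℓw<ℓsw , act⁻¹-δ-≥𝟎 w s (ℕₚ.<⇒≤ ℓw<ℓsw))
  ... | no ℓw≮ℓsw = inj₂ (ℓsw<ℓw , ≤0)
    where
    ℓsw≤ℓw : ℓ (s ∷ w) ≤ ℓ w
    ℓsw≤ℓw = ℕₚ.≮⇒≥ ℓw≮ℓsw
    ≤0 : act⁻¹ w (δ s) ≤𝟎
    ≤0 = -1⊛≥𝟎⇒≤𝟎 (≥𝟎-resp (act⁻¹-∷-δ-self w s)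
           (act⁻¹-δ-≥𝟎 (s ∷ w) s (subst (ℓ (s ∷ w) ≤_) (sym (ℓ-resp (s²≈id s w))) ℓsw≤ℓw)))
    ℓsw<ℓw : ℓ (s ∷ w) < ℓ w
    ℓsw<ℓw = ℕₚ.≤∧≢⇒< ℓsw≤ℓw λ ℓsw≡ℓw → act⁻¹-δ-¬≥𝟎∧≤𝟎 w s (act⁻¹-δ-≥𝟎 w s (ℕₚ.≤-reflexive (sym ℓsw≡ℓw))) ≤0

  reduced-head-≤𝟎 : ∀ {u j r} → j ∷ r ≈ u → length (j ∷ r) ≡ ℓ u → act⁻¹ u (δ j) ≤𝟎
  reduced-head-≤𝟎 {u} {j} jr≈u |jr|≡ℓu with ascent⊎descent u j
  ... | inj₁ (ℓu<ℓju , _) = ⊥-elim (ℕₚ.<-asym ℓu<ℓju (reduced-head-descent jr≈u |jr|≡ℓu))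
  ... | inj₂ (_ , ≤0)     = ≤0

  ℓ-drop-orthogonal : ∀ L u → Unique L → Orthogonal L → (∀ {j} → j ∈ L → act⁻¹ u (δ j) ≤𝟎) →
                      ℓ (L ++ u) ℕ.+ length L ≤ ℓ u
  ℓ-drop-orthogonal []      u _             _    _       = ℕₚ.≤-reflexive (ℕₚ.+-identityʳ (ℓ u))
  ℓ-drop-orthogonal (j ∷ L) u (j∉L′ ∷ uniq) orth descents with ascent⊎descent (L ++ u) j
  ... | inj₂ (ℓjLu<ℓLu , _) = begin
    ℓ (j ∷ L ++ u) ℕ.+ suc (length L)    ≡⟨ ℕₚ.+-suc (ℓ (j ∷ L ++ u)) (length L) ⟩
    suc (ℓ (j ∷ L ++ u)) ℕ.+ length L    ≤⟨ ℕₚ.+-monoˡ-≤ (length L) ℓjLu<ℓLu ⟩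
    ℓ (L ++ u) ℕ.+ length L              ≤⟨ ℓ-drop-orthogonal L u uniq (λ j∈L k∈L → orth (there j∈L) (there k∈L)) (descents ∘ there) ⟩
    ℓ u                                  ∎
    where open ℕₚ.≤-Reasoning
  ... | inj₁ (_ , ≥0) = ⊥-elim (act⁻¹-δ-¬≥𝟎∧≤𝟎 u j (≥𝟎-resp act⁻¹≡ ≥0) (descents (here refl)))
    where
    j-orth : ∀ {l} → l ∈ L → M l j ≡ + 0
    j-orth l∈L = orth (there l∈L) (here refl) λ { refl → All.lookup j∉L′ l∈L refl }
    act⁻¹≡ : act⁻¹ (L ++ u) (δ j) ≗ act⁻¹ u (δ j)
    act⁻¹≡ k = trans (cong-app (act⁻¹-++ L u (δ j)) k) (act-cong (reverse u) (act⁻¹-δ-fixed L j j-orth) k)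

module FoldingProperties {n N : ℕ} (S : FoldingSetting n N) where
  open FoldingSetting S
  open Folding S

  orb-π : ∀ j → orb (π ⟨$⟩ʳ j) ≡ orb j
  orb-π j = sym (Equivalence.from (orb-spec j (π ⟨$⟩ʳ j)) (1 , refl))

  B-same-orbit : ∀ {j k} → j ≢ k → orb j ≡ orb k → B j k ≡ + 0
  B-same-orbit {j} {k} j≢k orbj≡orbk = π-adm j k j≢k (Equivalence.to (orb-spec j k) orbj≡orbk)

  rep : Fin n → Fin N
  rep i = proj₁ (orb-surj i)

  orb-rep : ∀ i → orb (rep i) ≡ i
  orb-rep i = proj₂ (orb-surj i)

  ∈-orbit⁺ : ∀ {i l} → orb l ≡ i → l ∈ orbit orb i
  ∈-orbit⁺ {i} {l} = ∈-filter⁺ (λ j → orb j ≟ i) (∈-allFin l)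

  ∈-orbit⁻ : ∀ {i l} → l ∈ orbit orb i → orb l ≡ i
  ∈-orbit⁻ {i} l∈ = proj₂ (∈-filter⁻ (λ j → orb j ≟ i) {xs = allFin N} l∈)

  orbit-unique : ∀ i → Unique (orbit orb i)
  orbit-unique i = Uniqueₚ.filter⁺ (λ j → orb j ≟ i) (Uniqueₚ.allFin⁺ N)

  orbitSum : Fin n → (Fin N → ℤ) → ℤ
  orbitSum i g = sum (λ j → g j * δ i (orb j))

  orbitSum-cong : ∀ i {g h} → (∀ j → orb j ≡ i → g j ≡ h j) → orbitSum i g ≡ orbitSum i h
  orbitSum-cong i {g} {h} g≡h = sum-cong-≗ term
    where
    term : ∀ j → g j * δ i (orb j) ≡ h j * δ i (orb j)
    term j with orb j ≟ i
    ... | yes orbj≡i = cong (_* + 1) (g≡h j orbj≡i)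
    ... | no _       = trans (ℤₚ.*-zeroʳ (g j)) (sym (ℤₚ.*-zeroʳ (h j)))

  orbitSum-⊕ : ∀ i g h → orbitSum i (g ⊕ h) ≡ orbitSum i g + orbitSum i h
  orbitSum-⊕ i g h = trans (sum-cong-≗ (λ j → ℤₚ.*-distribʳ-+ (δ i (orb j)) (g j) (h j))) (∑-distrib-+ {N} _ _)

  orbitSum-⊛ : ∀ i z g → orbitSum i (z ⊛ g) ≡ z * orbitSum i g
  orbitSum-⊛ i z g = trans (sum-cong-≗ (λ j → ℤₚ.*-assoc z (g j) (δ i (orb j)))) (sym (*-distribˡ-sum {N} z _))

  orbitSum-comm : ∀ i i' (g : Fin N → Fin N → ℤ) →
                  orbitSum i (λ j → orbitSum i' (g j)) ≡ orbitSum i' (λ l → orbitSum i (λ j → g j l))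
  orbitSum-comm i i' g = begin
    sum (λ j → sum (λ l → g j l * δ i' (orb l)) * δ i (orb j))    ≡⟨ sum-cong-≗ (λ j → *-distribʳ-sum {N} (δ i (orb j)) _) ⟩
    sum (λ j → sum (λ l → g j l * δ i' (orb l) * δ i (orb j)))    ≡⟨ ∑-comm {N} {N} _ ⟩
    sum (λ l → sum (λ j → g j l * δ i' (orb l) * δ i (orb j)))    ≡⟨ sum-cong-≗ (λ l → sum-cong-≗ (λ j → lemma (g j l) _ _)) ⟩
    sum (λ l → sum (λ j → g j l * δ i (orb j) * δ i' (orb l)))    ≡⟨ sum-cong-≗ (λ l → *-distribʳ-sum {N} (δ i' (orb l)) _) ⟨
    sum (λ l → sum (λ j → g j l * δ i (orb j)) * δ i' (orb l))    ∎
    where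
    open ≡-Reasoning
    lemma : ∀ x a b → x * a * b ≡ x * b * a
    lemma = solve-∀

  orbitSum-const : ∀ i z → orbitSum i (λ _ → z) ≡ z * + card orb i
  orbitSum-const i z = begin
    sum (λ j → z * δ i (orb j))     ≡⟨ *-distribˡ-sum {N} z _ ⟨
    z * sum (λ j → δ i (orb j))     ≡⟨ cong (z *_) (sum-indicator (λ j → orb j ≟ i) (λ j → j)) ⟩
    z * + card orb i                ∎
    where open ≡-Reasoning

  sumF-restrict≡orbitSum : ∀ i g → sumF (λ j → if does (orb j ≟ i) then g j else + 0) ≡ orbitSum i g
  sumF-restrict≡orbitSum i g = trans (sumF≡sum {N} _) (sum-cong-≗ term)
    where
    term : ∀ j → (if does (orb j ≟ i) then g j else + 0) ≡ g j * δ i (orb j)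
    term j with orb j ≟ i
    ... | yes _ = sym (ℤₚ.*-identityʳ (g j))
    ... | no _  = sym (ℤₚ.*-zeroʳ (g j))

  card-nonzero : ∀ i → Σ ℕ λ m → card orb i ≡ suc m
  card-nonzero i with orbit orb i | ∈-orbit⁺ (orb-rep i)
  ... | x ∷ xs | _ = length xs , refl

  *-cancel-card : ∀ i {x y} → + card orb i * x ≡ + card orb i * y → x ≡ y
  *-cancel-card i {x} {y} eq with card-nonzero i
  ... | m , card≡ = ℤₚ.*-cancelˡ-≡ (+ suc m) x y (subst (λ c → + c * x ≡ + c * y) card≡ eq)

  columnSum : Fin n → Fin N → ℤ
  columnSum i l = orbitSum i (λ j → B j l)

  columnSum-π : ∀ i l → columnSum i (π ⟨$⟩ʳ l) ≡ columnSum i l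
  columnSum-π i l = begin
    sum (λ j → B j (π ⟨$⟩ʳ l) * δ i (orb j))                          ≡⟨ sum-permute {N} _ π ⟩
    sum (λ j → B (π ⟨$⟩ʳ j) (π ⟨$⟩ʳ l) * δ i (orb (π ⟨$⟩ʳ j)))         ≡⟨ sum-cong-≗ (λ j → cong₂ _*_ (π-inv j l) (cong (δ i) (orb-π j))) ⟩
    sum (λ j → B j l * δ i (orb j))                                    ∎
    where open ≡-Reasoning

  columnSum-orbit : ∀ i {k l} → orb l ≡ orb k → columnSum i l ≡ columnSum i k
  columnSum-orbit i {k} orbl≡orbk with Equivalence.to (orb-spec k _) (sym orbl≡orbk)
  ... | m , refl = along m
    where
    along : ∀ m → columnSum i (iter π m k) ≡ columnSum i k
    along zero    = refl
    along (suc m) = trans (columnSum-π i (iter π m k)) (along m)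

  -- Sum A-def over the row orbit O_i; columnSum i is constant on π-orbits and the orbit sizes cancel.
  columnSum≡A : ∀ i k → columnSum i k ≡ A i (orb k)
  columnSum≡A i k = sym (*-cancel-card (orb k) (*-cancel-card i (begin
    c * (c″ * A i i″)                               ≡⟨ lemma₁ c c″ (A i i″) ⟩
    (c″ * A i i″) * c                               ≡⟨ orbitSum-const i (c″ * A i i″) ⟨
    orbitSum i (λ _ → c″ * A i i″)                  ≡⟨ orbitSum-cong i (λ j orbj≡i → trans (A-def i i″ j orbj≡i)
                                                          (cong (c *_) (sumF-restrict≡orbitSum i″ (B j)))) ⟩
    orbitSum i (λ j → c * orbitSum i″ (B j))        ≡⟨ orbitSum-⊛ i c _ ⟩
    c * orbitSum i (λ j → orbitSum i″ (B j))        ≡⟨ cong (c *_) (orbitSum-comm i i″ B) ⟩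
    c * orbitSum i″ (columnSum i)                   ≡⟨ cong (c *_) (orbitSum-cong i″ (λ l → columnSum-orbit i)) ⟩
    c * orbitSum i″ (λ _ → columnSum i k)           ≡⟨ cong (c *_) (orbitSum-const i″ (columnSum i k)) ⟩
    c * (columnSum i k * c″)                        ≡⟨ cong (c *_) (ℤₚ.*-comm (columnSum i k) c″) ⟩
    c * (c″ * columnSum i k)                        ∎)))
    where
    open ≡-Reasoning
    i″ = orb k
    c  = + card orb i
    c″ = + card orb i″
    lemma₁ : ∀ a b x → a * (b * x) ≡ (b * x) * a
    lemma₁ = solve-∀

  columnSum-term-nonpos : ∀ i k → orb k ≢ i → ∀ j → B j k * δ i (orb j) ℤ.≤ + 0
  columnSum-term-nonpos i k orbk≢i j with orb j ≟ i
  ... | yes orbj≡i = subst (ℤ._≤ + 0) (sym (ℤₚ.*-identityʳ (B j k)))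
                       (IsGCM.offdiag B-gcm j k λ { refl → orbk≢i orbj≡i })
  ... | no _       = subst (ℤ._≤ + 0) (sym (ℤₚ.*-zeroʳ (B j k))) ℤₚ.≤-refl

  A≡columnSum-rep : ∀ i i' → A i i' ≡ columnSum i (rep i')
  A≡columnSum-rep i i' = trans (cong (A i) (sym (orb-rep i'))) (sym (columnSum≡A i (rep i')))

  A-diag : ∀ i → A i i ≡ + 2
  A-diag i = trans (A≡columnSum-rep i i) (trans (sum-cong-≗ term) (sum-δ (λ _ → + 2) (rep i)))
    where
    term : ∀ j → B j (rep i) * δ i (orb j) ≡ + 2 * δ (rep i) j
    term j with orb j ≟ i | j ≟ rep i
    ... | yes _        | yes refl = cong (_* + 1) (IsGCM.diag B-gcm j)
    ... | yes orbj≡i   | no j≢rep = cong (_* + 1) (B-same-orbit j≢rep (trans orbj≡i (sym (orb-rep i))))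
    ... | no orbj≢i    | yes refl = contradiction (orb-rep i) orbj≢i
    ... | no _         | no _     = ℤₚ.*-zeroʳ (B j (rep i))

  A-offdiag : ∀ i i' → i ≢ i' → A i i' ℤ.≤ + 0
  A-offdiag i i' i≢i' = subst (ℤ._≤ + 0) (sym (A≡columnSum-rep i i'))
    (sum-nonpos _ (columnSum-term-nonpos i (rep i') λ orb≡i → i≢i' (trans (sym orb≡i) (orb-rep i'))))

  A-zeroSym : ∀ i i' → A i i' ≡ + 0 → A i' i ≡ + 0
  A-zeroSym i i' Aii'≡0 with i ≟ i'
  ... | yes refl = Aii'≡0
  ... | no i≢i'  = begin
    A i' i                           ≡⟨ A≡columnSum-rep i' i ⟩
    orbitSum i' (λ l → B l (rep i))  ≡⟨ orbitSum-cong i' (λ l orbl≡i' → IsGCM.zeroSym B-gcm (rep i) l (B-rep-zero l orbl≡i')) ⟩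
    orbitSum i' (λ _ → + 0)          ≡⟨ orbitSum-const i' (+ 0) ⟩
    + 0                              ∎
    where
    open ≡-Reasoning
    B-rep-zero : ∀ l → orb l ≡ i' → B (rep i) l ≡ + 0
    B-rep-zero l orbl≡i' = begin
      B (rep i) l                        ≡⟨ ℤₚ.*-identityʳ (B (rep i) l) ⟨
      B (rep i) l * + 1                  ≡⟨ cong (λ e → B (rep i) l * e) (δ-diag i) ⟨
      B (rep i) l * δ i i                ≡⟨ cong (λ x → B (rep i) l * δ i x) (orb-rep i) ⟨
      B (rep i) l * δ i (orb (rep i))    ≡⟨ sum-nonpos-≡0 _ (columnSum-term-nonpos i l λ orbl≡i → i≢i' (trans (sym orbl≡i) orbl≡i'))
                                              (trans (columnSum≡A i l) (trans (cong (A i) orbl≡i') Aii'≡0)) (rep i) ⟩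
      + 0                                ∎

  A-gcm : IsGCM A
  A-gcm = record { diag = A-diag ; offdiag = A-offdiag ; zeroSym = A-zeroSym }

  sum-fibres : ∀ (f : Fin n → ℤ) (g : Fin N → ℤ) → sum (λ j → f (orb j) * g j) ≡ sum (λ i → f i * orbitSum i g)
  sum-fibres f g = begin
    sum (λ j → f (orb j) * g j)                          ≡⟨ sum-cong-≗ (λ j → sum-δ (λ i → f i * g j) (orb j)) ⟨
    sum (λ j → sum (λ i → f i * g j * δ (orb j) i))       ≡⟨ ∑-comm {N} {n} _ ⟩
    sum (λ i → sum (λ j → f i * g j * δ (orb j) i))       ≡⟨ sum-cong-≗ (λ i → trans (sum-cong-≗ (λ j → term i j)) (sym (*-distribˡ-sum {N} (f i) _))) ⟩
    sum (λ i → f i * orbitSum i g)                       ∎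
    where
    open ≡-Reasoning
    term : ∀ i j → f i * g j * δ (orb j) i ≡ f i * (g j * δ i (orb j))
    term i j = trans (ℤₚ.*-assoc (f i) (g j) _) (cong (λ e → f i * (g j * e)) (δ-sym (orb j) i))

  φK-central : ∀ K → InZPlus A K → InZPlus B (φ K)
  φK-central K K-central k = begin
    sumF (λ j → + K (orb j) * B j k)                 ≡⟨ sumF≡sum {N} _ ⟩
    sum (λ j → + K (orb j) * B j k)                  ≡⟨ sum-fibres (λ i → + K i) (λ j → B j k) ⟩
    sum (λ i → + K i * columnSum i k)                ≡⟨ sum-cong-≗ (λ i → cong (+ K i *_) (columnSum≡A i k)) ⟩
    sum (λ i → + K i * A i (orb k))                  ≡⟨ sumF≡sum {n} _ ⟨
    sumF (λ i → + K i * A i (orb k))                 ≡⟨ K-central (orb k) ⟩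
    + 0                                              ∎
    where open ≡-Reasoning

  module WA = PositiveRoots A A-gcm
  module WB = PositiveRoots B B-gcm

  χ : Lattice N → Lattice n
  χ c i = orbitSum i c

  χ-cong : ∀ {c d} → c ≗ d → χ c ≗ χ d
  χ-cong c≗d i = orbitSum-cong i (λ j _ → c≗d j)

  orbitSum-⟪⟫ : ∀ i c → orbitSum i (λ l → WB.⟪ l , c ⟫) ≡ WA.⟪ i , χ c ⟫
  orbitSum-⟪⟫ i c = begin
    sum (λ l → sum (λ m → B l m * c m) * δ i (orb l))    ≡⟨ sum-cong-≗ (λ l → *-distribʳ-sum {N} (δ i (orb l)) _) ⟩
    sum (λ l → sum (λ m → B l m * c m * δ i (orb l)))    ≡⟨ ∑-comm {N} {N} _ ⟩
    sum (λ m → sum (λ l → B l m * c m * δ i (orb l)))    ≡⟨ sum-cong-≗ (λ m → sum-cong-≗ (λ l → lemma (B l m) (c m) _)) ⟩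
    sum (λ m → sum (λ l → B l m * δ i (orb l) * c m))    ≡⟨ sum-cong-≗ (λ m → *-distribʳ-sum {N} (c m) _) ⟨
    sum (λ m → columnSum i m * c m)                       ≡⟨ sum-cong-≗ (λ m → cong (_* c m) (columnSum≡A i m)) ⟩
    sum (λ m → A i (orb m) * c m)                         ≡⟨ sum-fibres (A i) c ⟩
    sum (λ i' → A i i' * orbitSum i' c)                   ∎
    where
    open ≡-Reasoning
    lemma : ∀ b x e → b * x * e ≡ b * e * x
    lemma = solve-∀

  -- The product of the reflections s_l, l ∈ O_i: they are pairwise orthogonal, so each one only
  -- changes its own coordinate.
  blockAction : Fin n → Lattice N → Lattice N
  blockAction i c l = c l - WB.⟪ l , c ⟫ * δ i (orb l)

  χ-blockAction : ∀ i c → χ (blockAction i c) ≗ sref A i (χ c)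
  χ-blockAction i c i' = begin
    orbitSum i' (blockAction i c)                           ≡⟨ orbitSum-cong i' (λ l orbl≡i' → cong (λ e → c l - ⟪ l , c ⟫ * δ i e) orbl≡i') ⟩
    orbitSum i' (λ l → c l - ⟪ l , c ⟫ * δ i i')            ≡⟨ sum-cong-≗ (λ l → cong (_* δ i' (orb l)) (lemma₁ (c l) ⟪ l , c ⟫ (δ i i'))) ⟩
    orbitSum i' (c ⊕ (- δ i i') ⊛ (λ l → ⟪ l , c ⟫))        ≡⟨ orbitSum-⊕ i' c _ ⟩
    χ c i' + orbitSum i' ((- δ i i') ⊛ (λ l → ⟪ l , c ⟫))   ≡⟨ cong (_+_ (χ c i')) (orbitSum-⊛ i' (- δ i i') _) ⟩
    χ c i' + (- δ i i') * orbitSum i' (λ l → ⟪ l , c ⟫)     ≡⟨ cong (λ x → χ c i' + (- δ i i') * x) (orbitSum-⟪⟫ i' c) ⟩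
    χ c i' + (- δ i i') * WA.⟪ i' , χ c ⟫                   ≡⟨ lemma₂ (χ c i') (δ i i') WA.⟪ i' , χ c ⟫ ⟩
    χ c i' - δ i i' * WA.⟪ i' , χ c ⟫                       ≡⟨ cong (_-_ (χ c i')) (δ-* (λ i → WA.⟪ i , χ c ⟫) i i') ⟩
    χ c i' - WA.⟪ i , χ c ⟫ * δ i i'                        ≡⟨ WA.sref-≡ i (χ c) i' ⟨
    sref A i (χ c) i'                                       ∎
    where
    open ≡-Reasoning
    open WB using (⟪_,_⟫)
    lemma₁ : ∀ a x e → a - x * e ≡ a + (- e) * x
    lemma₁ = solve-∀
    lemma₂ : ∀ a e x → a + (- e) * x ≡ a - e * x
    lemma₂ = solve-∀

  act-block : ∀ i L → Unique L → (∀ {l} → orb l ≡ i → l ∈ L) → (∀ {l} → l ∈ L → orb l ≡ i) →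
              ∀ c → act B L c ≗ blockAction i c
  act-block i L uniq ∈L⁺ ∈L⁻ c l with orb l ≟ i | WB.act-orthogonal L uniq orthogonal c l
    where
    orthogonal : WB.Orthogonal L
    orthogonal j∈L k∈L j≢k = B-same-orbit j≢k (trans (∈L⁻ j∈L) (sym (∈L⁻ k∈L)))
  ... | yes orbl≡i | on-block , _  = trans (on-block (∈L⁺ orbl≡i)) (sym (cong (_-_ (c l)) (ℤₚ.*-identityʳ _)))
  ... | no orbl≢i  | _ , off-block = trans (off-block (orbl≢i ∘ ∈L⁻)) (sym (lemma (c l) WB.⟪ l , c ⟫))
    where
    lemma : ∀ a x → a - x * + 0 ≡ a
    lemma = solve-∀

  act-orbit : ∀ i c → act B (orbit orb i) c ≗ blockAction i c
  act-orbit i = act-block i (orbit orb i) (orbit-unique i) ∈-orbit⁺ ∈-orbit⁻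

  act-σ-orbit : ∀ i c → act B (σ (orbit orb i)) c ≗ blockAction i c
  act-σ-orbit i = act-block i (σ (orbit orb i)) (Uniqueₚ.map⁺ π-injective (orbit-unique i)) ∈σ⁺ ∈σ⁻
    where
    π-injective : ∀ {x y} → π ⟨$⟩ʳ x ≡ π ⟨$⟩ʳ y → x ≡ y
    π-injective {x} {y} πx≡πy = trans (sym (inverseˡ π)) (trans (cong (π ⟨$⟩ˡ_) πx≡πy) (inverseˡ π))
    ∈σ⁺ : ∀ {l} → orb l ≡ i → l ∈ σ (orbit orb i)
    ∈σ⁺ {l} orbl≡i = subst (_∈ σ (orbit orb i)) (inverseʳ π)
      (∈-map⁺ (π ⟨$⟩ʳ_) (∈-orbit⁺ (trans (sym (orb-π (π ⟨$⟩ˡ l))) (trans (cong orb (inverseʳ π)) orbl≡i))))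
    ∈σ⁻ : ∀ {l} → l ∈ σ (orbit orb i) → orb l ≡ i
    ∈σ⁻ l∈ with ∈-map⁻ (π ⟨$⟩ʳ_) l∈
    ... | x , x∈ , refl = trans (orb-π x) (∈-orbit⁻ x∈)

  act⁻¹-orbit : ∀ i c → WB.act⁻¹ (orbit orb i) c ≗ blockAction i c
  act⁻¹-orbit i = act-block i (reverse (orbit orb i)) reverse-unique
                    (Anyₚ.reverse⁺ ∘ ∈-orbit⁺) (∈-orbit⁻ ∘ Anyₚ.reverse⁻)
    where
    reverse-unique : Unique (reverse (orbit orb i))
    reverse-unique = Permₚ.Unique-resp-↭ (setoid (Fin N)) (Perm.↭-sym (setoid (Fin N)) (Permₚ.↭-reverse (setoid (Fin N)) (orbit orb i)))
                       (orbit-unique i)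

  χ-act : ∀ w c → χ (act B (f w) c) ≗ act A w (χ c)
  χ-act []      c i = refl
  χ-act (i ∷ w) c i' = begin
    χ (act B (orbit orb i ++ f w) c) i'         ≡⟨ χ-cong (λ l → cong-app (WB.act-++ (orbit orb i) (f w) c) l) i' ⟩
    χ (act B (orbit orb i) (act B (f w) c)) i'  ≡⟨ χ-cong (act-orbit i (act B (f w) c)) i' ⟩
    χ (blockAction i (act B (f w) c)) i'        ≡⟨ χ-blockAction i (act B (f w) c) i' ⟩
    sref A i (χ (act B (f w) c)) i'             ≡⟨ WA.sref-cong i (χ-act w c) i' ⟩
    sref A i (act A w (χ c)) i'                 ∎
    where open ≡-Reasoning

  χ-act⁻¹ : ∀ w c → χ (WB.act⁻¹ (f w) c) ≗ WA.act⁻¹ w (χ c)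
  χ-act⁻¹ w c i = begin
    χ (WB.act⁻¹ (f w) c) i                                ≡⟨ WA.act⁻¹-act w (χ (WB.act⁻¹ (f w) c)) i ⟨
    WA.act⁻¹ w (act A w (χ (WB.act⁻¹ (f w) c))) i         ≡⟨ WA.act-cong (reverse w) (χ-act w (WB.act⁻¹ (f w) c)) i ⟨
    WA.act⁻¹ w (χ (act B (f w) (WB.act⁻¹ (f w) c))) i     ≡⟨ WA.act-cong (reverse w) (χ-cong (WB.act-act⁻¹ (f w) c)) i ⟩
    WA.act⁻¹ w (χ c) i                                    ∎
    where open ≡-Reasoning

  χ-δ : ∀ j → χ (δ j) ≗ δ (orb j)
  χ-δ j i = trans (sum-cong-≗ (λ l → ℤₚ.*-comm (δ j l) (δ i (orb l)))) (trans (sum-δ (λ l → δ i (orb l)) j) (δ-sym i (orb j)))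

  χ-≤𝟎 : ∀ {c} → c ≤𝟎 → χ c ≤𝟎
  χ-≤𝟎 {c} c≤0 i = sum-nonpos _ term
    where
    term : ∀ j → c j * δ i (orb j) ℤ.≤ + 0
    term j with orb j ≟ i
    ... | yes _ = subst (ℤ._≤ + 0) (sym (ℤₚ.*-identityʳ (c j))) (c≤0 j)
    ... | no _  = subst (ℤ._≤ + 0) (sym (ℤₚ.*-zeroʳ (c j))) ℤₚ.≤-refl

  χ-invariant⇒≈[] : ∀ y → (∀ c → χ (act B y c) ≗ χ c) → y WB.≈ []
  χ-invariant⇒≈[] y χ-inv with WB.reducedWord y
  ... | []    , _       , []≈y = WB.≈-sym []≈y
  ... | j ∷ r , |jr|≡ℓy , jr≈y =
    contradiction (χ-≤𝟎 (WB.reduced-head-≤𝟎 jr≈y |jr|≡ℓy) (orb j)) (subst (λ x → ¬ x ℤ.≤ + 0) (sym χ-root) λ { (ℤ.+≤+ ()) })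
    where
    χ-root : χ (WB.act⁻¹ y (δ j)) (orb j) ≡ + 1
    χ-root = begin
      χ (WB.act⁻¹ y (δ j)) (orb j)                  ≡⟨ χ-inv (WB.act⁻¹ y (δ j)) (orb j) ⟨
      χ (act B y (WB.act⁻¹ y (δ j))) (orb j)        ≡⟨ χ-cong (WB.act-act⁻¹ y (δ j)) (orb j) ⟩
      χ (δ j) (orb j)                               ≡⟨ χ-δ j (orb j) ⟩
      δ (orb j) (orb j)                             ≡⟨ δ-diag (orb j) ⟩
      + 1                                           ∎
      where open ≡-Reasoning

  f-resp : ∀ u v → u WA.≈ v → f u WB.≈ f v
  f-resp u v u≈v = WB.mk≈ λ c k → begin
    act B (f u) c k                                   ≡⟨ WB.act-act⁻¹ (f v) (act B (f u) c) k ⟨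
    act B (f v) (WB.act⁻¹ (f v) (act B (f u) c)) k    ≡⟨ WB.act-cong (f v) (λ l → trans (sym (act-y c l)) (WB.act-≈ y≈[] c l)) k ⟩
    act B (f v) c k                                   ∎
    where
    open ≡-Reasoning
    y = reverse (f v) ++ f u
    act-y : ∀ c → act B y c ≗ WB.act⁻¹ (f v) (act B (f u) c)
    act-y c = cong-app (WB.act-++ (reverse (f v)) (f u) c)
    χ-invariant : ∀ c → χ (act B y c) ≗ χ c
    χ-invariant c i = begin
      χ (act B y c) i                                ≡⟨ χ-cong (act-y c) i ⟩
      χ (WB.act⁻¹ (f v) (act B (f u) c)) i           ≡⟨ χ-act⁻¹ v (act B (f u) c) i ⟩
      WA.act⁻¹ v (χ (act B (f u) c)) i               ≡⟨ WA.act-cong (reverse v) (χ-act u c) i ⟩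
      WA.act⁻¹ v (act A u (χ c)) i                   ≡⟨ WA.act-cong (reverse v) (WA.act-≈ u≈v (χ c)) i ⟩
      WA.act⁻¹ v (act A v (χ c)) i                   ≡⟨ WA.act⁻¹-act v (χ c) i ⟩
      χ c i                                          ∎
    y≈[] : y WB.≈ []
    y≈[] = χ-invariant⇒≈[] y χ-invariant

  lift : Lattice n → Lattice N
  lift c j = c (orb j) * δ (rep (orb j)) j

  χ-lift : ∀ c → χ (lift c) ≗ c
  χ-lift c i = trans (sum-cong-≗ term) (sum-δ (λ _ → c i) (rep i))
    where
    term : ∀ j → lift c j * δ i (orb j) ≡ c i * δ (rep i) j
    term j with orb j ≟ i
    ... | yes refl   = ℤₚ.*-identityʳ (lift c j)
    ... | no orbj≢i  = trans (ℤₚ.*-zeroʳ (lift c j))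
                         (sym (trans (cong (c i *_) (δ-off λ j≡rep → orbj≢i (trans (cong orb j≡rep) (orb-rep i))))
                                     (ℤₚ.*-zeroʳ (c i))))

  f-injective : ∀ u v → f u WB.≈ f v → u WA.≈ v
  f-injective u v fu≈fv = WA.mk≈ λ c k → begin
    act A u c k                      ≡⟨ WA.act-cong u (χ-lift c) k ⟨
    act A u (χ (lift c)) k           ≡⟨ χ-act u (lift c) k ⟨
    χ (act B (f u) (lift c)) k       ≡⟨ χ-cong (WB.act-≈ fu≈fv (lift c)) k ⟩
    χ (act B (f v) (lift c)) k       ≡⟨ χ-act v (lift c) k ⟩
    act A v (χ (lift c)) k           ≡⟨ WA.act-cong v (χ-lift c) k ⟩
    act A v c k                      ∎
    where open ≡-Reasoning

  Fixed-orbit-++ : ∀ i {u} → σ u WB.≈ u → σ (orbit orb i ++ u) WB.≈ orbit orb i ++ u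
  Fixed-orbit-++ i {u} σu≈u = WB.mk≈ λ c k → begin
    act B (σ (orbit orb i ++ u)) c k                  ≡⟨ cong (λ w → act B w c k) (Listₚ.map-++ (π ⟨$⟩ʳ_) (orbit orb i) u) ⟩
    act B (σ (orbit orb i) ++ σ u) c k                ≡⟨ cong-app (WB.act-++ (σ (orbit orb i)) (σ u) c) k ⟩
    act B (σ (orbit orb i)) (act B (σ u) c) k         ≡⟨ act-σ-orbit i (act B (σ u) c) k ⟩
    blockAction i (act B (σ u) c) k                   ≡⟨ act-orbit i (act B (σ u) c) k ⟨
    act B (orbit orb i) (act B (σ u) c) k             ≡⟨ WB.act-cong (orbit orb i) (WB.act-≈ σu≈u c) k ⟩
    act B (orbit orb i) (act B u c) k                 ≡⟨ cong-app (WB.act-++ (orbit orb i) u c) k ⟨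
    act B (orbit orb i ++ u) c k                      ∎
    where open ≡-Reasoning

  f-fixed : ∀ w → σ (f w) WB.≈ f w
  f-fixed []      = WB.≈-refl
  f-fixed (i ∷ w) = Fixed-orbit-++ i (f-fixed w)

  orbit-involutive : ∀ i u → orbit orb i ++ (orbit orb i ++ u) WB.≈ u
  orbit-involutive i u = WB.mk≈ λ c k → begin
    act B (orbit orb i ++ (orbit orb i ++ u)) c k               ≡⟨ cong-app (WB.act-++ (orbit orb i) _ c) k ⟩
    act B (orbit orb i) (act B (orbit orb i ++ u) c) k          ≡⟨ WB.act-cong (orbit orb i) (λ l → cong-app (WB.act-++ (orbit orb i) u c) l) k ⟩
    act B (orbit orb i) (act B (orbit orb i) (act B u c)) k     ≡⟨ WB.act-cong (orbit orb i) (orbit≗orbit⁻¹ (act B u c)) k ⟩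
    act B (orbit orb i) (WB.act⁻¹ (orbit orb i) (act B u c)) k  ≡⟨ WB.act-act⁻¹ (orbit orb i) (act B u c) k ⟩
    act B u c k                                                 ∎
    where
    open ≡-Reasoning
    orbit≗orbit⁻¹ : ∀ d → act B (orbit orb i) d ≗ WB.act⁻¹ (orbit orb i) d
    orbit≗orbit⁻¹ d l = trans (act-orbit i d l) (sym (act⁻¹-orbit i d l))

  permute : Lattice N → Lattice N
  permute c l = c (π ⟨$⟩ˡ l)

  permute-δ : ∀ t → permute (δ t) ≗ δ (π ⟨$⟩ʳ t)
  permute-δ t l with l ≟ π ⟨$⟩ʳ t | π ⟨$⟩ˡ l ≟ t
  ... | yes _     | yes _     = refl
  ... | no _      | no _      = refl
  ... | yes l≡πt  | no πˡl≢t  = contradiction (trans (cong (π ⟨$⟩ˡ_) l≡πt) (inverseˡ π)) πˡl≢t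
  ... | no l≢πt   | yes πˡl≡t = contradiction (trans (sym (inverseʳ π)) (cong (π ⟨$⟩ʳ_) πˡl≡t)) l≢πt

  sref-permute : ∀ t c → sref B (π ⟨$⟩ʳ t) (permute c) ≗ permute (sref B t c)
  sref-permute t c l = begin
    sref B (π ⟨$⟩ʳ t) (permute c) l                                   ≡⟨ WB.sref-≡ (π ⟨$⟩ʳ t) (permute c) l ⟩
    permute c l - WB.⟪ π ⟨$⟩ʳ t , permute c ⟫ * δ (π ⟨$⟩ʳ t) l        ≡⟨ cong₂ (λ x e → permute c l - x * e) ⟪πt,πc⟫ (sym (permute-δ t l)) ⟩
    permute c l - WB.⟪ t , c ⟫ * δ t (π ⟨$⟩ˡ l)                       ≡⟨ WB.sref-≡ t c (π ⟨$⟩ˡ l) ⟨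
    permute (sref B t c) l                                            ∎
    where
    open ≡-Reasoning
    ⟪πt,πc⟫ : WB.⟪ π ⟨$⟩ʳ t , permute c ⟫ ≡ WB.⟪ t , c ⟫
    ⟪πt,πc⟫ = trans (sum-permute {N} _ π) (sum-cong-≗ (λ m → cong₂ _*_ (π-inv t m) (cong c (inverseˡ π))))

  act-σ-permute : ∀ u c → act B (σ u) (permute c) ≗ permute (act B u c)
  act-σ-permute []      c l = refl
  act-σ-permute (t ∷ u) c l =
    trans (WB.sref-cong (π ⟨$⟩ʳ t) (act-σ-permute u c) l) (sref-permute t (act B u c) l)

  act⁻¹-σ-permute : ∀ u c → WB.act⁻¹ (σ u) (permute c) ≗ permute (WB.act⁻¹ u c)
  act⁻¹-σ-permute u c l =
    trans (cong (λ w → act B w (permute c) l) (sym (Listₚ.reverse-map (π ⟨$⟩ʳ_) u))) (act-σ-permute (reverse u) c l)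

  descent-orbit : ∀ {u} → σ u WB.≈ u → ∀ {j k} → orb j ≡ orb k → WB.act⁻¹ u (δ j) ≤𝟎 → WB.act⁻¹ u (δ k) ≤𝟎
  descent-orbit {u} σu≈u {j} orbj≡orbk ≤0 with Equivalence.to (orb-spec j _) orbj≡orbk
  ... | m , refl = along m
    where
    along : ∀ m → WB.act⁻¹ u (δ (iter π m j)) ≤𝟎
    along zero    = ≤0
    along (suc m) l = subst (ℤ._≤ + 0) (sym step) (along m (π ⟨$⟩ˡ l))
      where
      j′ = iter π m j
      step : WB.act⁻¹ u (δ (π ⟨$⟩ʳ j′)) l ≡ WB.act⁻¹ u (δ j′) (π ⟨$⟩ˡ l)
      step = begin
        WB.act⁻¹ u (δ (π ⟨$⟩ʳ j′)) l          ≡⟨ WB.act-cong (reverse u) (permute-δ j′) l ⟨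
        WB.act⁻¹ u (permute (δ j′)) l         ≡⟨ WB.act⁻¹-resp (WB.≈-sym σu≈u) (permute (δ j′)) l ⟩
        WB.act⁻¹ (σ u) (permute (δ j′)) l     ≡⟨ act⁻¹-σ-permute u (δ j′) l ⟩
        WB.act⁻¹ u (δ j′) (π ⟨$⟩ˡ l)          ∎
        where open ≡-Reasoning

  f-onto : ∀ u → σ u WB.≈ u → Σ (Word n) λ w → f w WB.≈ u
  f-onto u = go u (<-wellFounded (WB.ℓ u))
    where
    go : ∀ u → Acc _<_ (WB.ℓ u) → σ u WB.≈ u → Σ (Word n) λ w → f w WB.≈ u
    go u (acc rs) σu≈u with WB.reducedWord u
    ... | []    , _      , []≈u  = [] , []≈u
    ... | j ∷ r , |jr|≡ℓu , jr≈u with go u′ (rs ℓu′<ℓu) (Fixed-orbit-++ i σu≈u)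
      where
      i  = orb j
      u′ = orbit orb i ++ u
      ℓu′<ℓu : WB.ℓ u′ < WB.ℓ u
      ℓu′<ℓu with card-nonzero i
      ... | m , card≡ = ℕₚ.<-≤-trans (ℕₚ.m<m+n (WB.ℓ u′) (subst (0 <_) (sym card≡) (s≤s z≤n)))
                          (WB.ℓ-drop-orthogonal (orbit orb i) u (orbit-unique i)
                            (λ j∈ k∈ j≢k → B-same-orbit j≢k (trans (∈-orbit⁻ j∈) (sym (∈-orbit⁻ k∈))))
                            (λ l∈ → descent-orbit σu≈u (sym (∈-orbit⁻ l∈)) (WB.reduced-head-≤𝟎 jr≈u |jr|≡ℓu)))
    ... | w′ , fw′≈u′ = orb j ∷ w′ , WB.≈-trans (WB.++-cong (WB.≈-refl {orbit orb (orb j)}) fw′≈u′) (orbit-involutive (orb j) u)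

  Cover-lift : ∀ v {i} → Cover A v i → ∀ j → orb j ≡ i → Cover B (f v) j
  Cover-lift v cover j refl with WB.ascent⊎descent (f v) j
  ... | inj₁ (ℓfv<ℓjfv , _) = WB.ascent⇒Cover ℓfv<ℓjfv
  ... | inj₂ (_ , ≤0) = ⊥-elim (WA.act⁻¹-δ-¬≥𝟎∧≤𝟎 v (orb j) (WA.act⁻¹-δ-≥𝟎 v (orb j) (ℕₚ.<⇒≤ (WA.Cover⇒ascent cover)))
                                  λ k → subst (ℤ._≤ + 0) (χ-root k) (χ-≤𝟎 ≤0 k))
    where
    χ-root : χ (WB.act⁻¹ (f v) (δ j)) ≗ WA.act⁻¹ v (δ (orb j))
    χ-root k = trans (χ-act⁻¹ v (δ j) k) (WA.act-cong (reverse v) (χ-δ j) k)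

  f-grade : ∀ w m → IsLength A w m ⇔ FoldGrade (f w) m
  f-grade w m = mk⇔ (λ w-length → w , (λ _ _ → refl) , w-length)
                    (λ { (w′ , fw′≈fw , w′-length) → WA.IsLength-resp (f-injective w′ w (WB.mk≈ fw′≈fw)) w′-length })

  f-injective-step : ∀ v x i y → f v ≈[ B ] f x → f (i ∷ v) ≈[ B ] f y → v WA.≈ x × y WA.≈ i ∷ x
  f-injective-step v x i y fv≈fx fiv≈fy =
    v≈x , WA.≈-trans (WA.≈-sym (f-injective (i ∷ v) y (WB.mk≈ fiv≈fy))) (WA.∷-cong i v≈x)
    where
    v≈x = f-injective v x (WB.mk≈ fv≈fx)

  edge-to : ∀ K {x y m} → EdgeMult A K x y m → FoldMult K (f x) (f y) m
  edge-to K {x} {y} {m} (inj₁ (k , y≈kx , cover , m≡Kk)) =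
    inj₁ (x , k , (λ _ _ → refl) , WB.act-≈ (f-resp (k ∷ x) y (WA.≈-sym (WA.mk≈ y≈kx))) , cover , lifted)
    where
    lifted : ∀ j → orb j ≡ k → EdgeMult B (φ K) (f x) (j ∷ f x) m
    lifted j orbj≡k = inj₁ (j , (λ _ _ → refl) , Cover-lift x cover j orbj≡k , trans m≡Kk (cong K (sym orbj≡k)))
  edge-to K {x} {y} (inj₂ (no-cover , m≡0)) = inj₂ (no-lifted-cover , m≡0)
    where
    no-lifted-cover : ∀ v i → f v ≈[ B ] f x → f (i ∷ v) ≈[ B ] f y → ¬ Cover A v i
    no-lifted-cover v i fv≈fx fiv≈fy cover = no-cover i (WA.act-≈ (proj₂ v≈x×y≈ix)) (WA.Cover-resp (proj₁ v≈x×y≈ix) cover)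
      where
      v≈x×y≈ix = f-injective-step v x i y fv≈fx fiv≈fy

  edge-from : ∀ K {x y m} → FoldMult K (f x) (f y) m → EdgeMult A K x y m
  edge-from K {x} {y} (inj₁ (v , i , fv≈fx , fiv≈fy , cover , lifted)) with lifted (rep i) (orb-rep i)
  ... | inj₁ (k , rep∷fv≈k∷fv , _ , m≡φKk) =
    inj₁ (i , WA.act-≈ (proj₂ v≈x×y≈ix) , WA.Cover-resp (proj₁ v≈x×y≈ix) cover ,
          trans m≡φKk (cong K (trans (cong orb (sym (WB.s-injective (rep i) k (f v) (WB.mk≈ rep∷fv≈k∷fv)))) (orb-rep i))))
    where
    v≈x×y≈ix = f-injective-step v x i y fv≈fx fiv≈fy
  ... | inj₂ (no-cover , _) = ⊥-elim (no-cover (rep i) (λ _ _ → refl) (Cover-lift v cover (rep i) (orb-rep i)))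
  edge-from K {x} {y} (inj₂ (no-cover , m≡0)) = inj₂ (no-cover′ , m≡0)
    where
    no-cover′ : ∀ k → y ≈[ A ] (k ∷ x) → ¬ Cover A x k
    no-cover′ k y≈kx = no-cover x k (λ _ _ → refl) (WB.act-≈ (f-resp (k ∷ x) y (WA.≈-sym (WA.mk≈ y≈kx))))

  f-edges : ∀ K x y m → EdgeMult A K x y m ⇔ FoldMult K (f x) (f y) m
  f-edges K x y m = mk⇔ (edge-to K {x} {y}) (edge-from K {x} {y})

corollary4p10 : ∀ {n N : ℕ} (S : FoldingSetting n N) (K : Fin n → ℕ) →
    InZPlus (FoldingSetting.A S) K → Folding.IsGradedIso S K
corollary4p10 S K K-central = record
  { φK-central  = φK-central K K-central
  ; f-resp      = λ u v u≈v → WB.act-≈ (f-resp u v (WA.mk≈ u≈v))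
  ; f-fixed     = λ w → WB.act-≈ (f-fixed w)
  ; f-injective = λ u v fu≈fv → WA.act-≈ (f-injective u v (WB.mk≈ fu≈fv))
  ; f-onto      = λ u σu≈u → map₂ WB.act-≈ (f-onto u (WB.mk≈ σu≈u))
  ; f-grade     = f-grade
  ; f-edges     = f-edges K
  }
  where open FoldingProperties S
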